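{- Let $\mathcal{P}=(G,s,t,\vec p)$ be a two-state stochastic PERT network and let $W_{\mathcal P}$ be the TPWN constructed from it as described below. Then $ET_{W_{\mathcal P}}=\mathbb{E}(PD(\mathcal P))$.
   Context: A two-state stochastic PERT network is $\mathcal{P}=(G,s,t,\vec p)$ where $G=(V,E)$ is a directed acyclic graph with a single source vertex $s$ and a single sink vertex $t$, and $\vec p\in\mathbb{Q}^E$ assigns to each edge $e$ a probability $p_e\in[0,1]$. Each edge $e$ defines a random variable $X_e$ with $\Pr(X_e=1)=p_e$, $\Pr(X_e=0)=1-p_e$, all $X_e$ independent. The project duration is $PD(\mathcal P)=\max_{\pi\in\Pi}\sum_{e\in\pi}X_e$, with $\Pi$ the set of paths from $s$ to $t$; $\mathbb{E}(PD(\mathcal P))$ is its expectation. Construction of $W_{\mathcal P}$: for each edge $e=(u,v)\in E$ add places $[u,e]$ and $[e,v]$ and two transitions $t_{e,0},t_{e,1}$, each with an arc from $[u,e]$ and an arc to $[e,v]$, with $w(t_{e,0})=1-p_e$, $w(t_{e,1})=p_e$, $\tau(t_{e,0})=0$, $\tau(t_{e,1})=1$. For each vertex $v\in V$ add a transition $t_v$ with arcs from every place $[e,v]$ with $e=(u,v)\in E$ and arcs to every place $[v,e]$ with $e=(v,x)\in E$; $w(t_v)=1$, $\tau(t_v)=0$. Add a place $i$ with an arc to $t_s$ and a place $o$ with an arc from $t_t$. This is a workflow net with initial place $i$ and final place $o$, which is sound, acyclic, free-choice, 1-safe and confusion-free. Definitions for the TPWN: a workflow net $(P,T,F,i,o)$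 has places, transitions, arcs $F$; markings, firing $M\xrightarrow{t}M'$ (remove a token from each input place, add one to each output place) as usual; $\mathbf{i}$ ($\mathbf{o}$) has a single token in $i$ (in $o$). For a reachable 1-safe marking $M$, two enabled transitions are in conflict if their presets intersect; $C(t,M)$ is the set of transitions in conflict with $t$ at $M$ (contains $t$) and $\mathcal{C}(M)=\{C(t,M):t\text{ enabled at }M\}$. A TPWN is $W=(N,w,\tau)$ with weights $w$ and times $\tau$. Timing: $\mathbb{N}_\bot=\{\bot\}\cup\mathbb{N}$, $\bot\le x$, $\bot+x=\bot$; $upd(\vec x,t)_p=\max_{q\in{}^\bullet t}\vec x_q+\tau(t)$ if $p\in t^\bullet$, $\bot$ if $p\in{}^\bullet t\setminus t^\bullet$, $\vec x_p$ otherwise; $\mu(\epsilon)_i=0$, $\mu(\epsilon)_p=\bot$ for $p\ne i$, $\mu(\sigma t)=upd(\mu(\sigma),t)$; $\mathit{time}(\sigma)=\max_p\mu(\sigma)_p$. MDP semantics: states are markings $M$ and pairs $(M,t)$ with $t$ enabled at $M$; from $M$ with no enabled transition, a Dirac self-loop; otherwise one distribution per $C\in\mathcal{C}(M)$ giving $(M,t)$ probability $w(t)/\sum_{u\in C}w(u)$ for $t\in C$; from $(M,t)$ probability 1 to $M'$ with $M\xrightarrow{t}M'$. A scheduler $S$ chooses an available distribution based on the path so far, inducing $\mathit{Prob}^S$. $\mathit{time}(\mathbf{o},\pi)$ is $\infty$ if the infinite path $\pi$ never visits $\mathbf{o}$, else $\mathit{time}$ of the transitions along the shortest prefix ending in $\mathbf{o}$;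 $ET^S_W$ is its expectation under $\mathit{Prob}^S$, which is the same for all $S$; $ET_W$ is this common value. -}

module Defs where

open import Data.Bool using (Bool; true; false; if_then_else_; _∧_; _∨_; not)
open import Data.Nat as ℕ using (ℕ; zero; suc; _∸_)
import Data.Nat.Properties as ℕP
open import Data.Fin using (Fin)
import Data.Fin.Properties as FinP
open import Data.List.Base using (List; []; _∷_; _++_; [_]; map; foldr; foldl; concatMap; length; take; inits; allFin; upTo)
open import Data.Bool.ListAction using (all; any)
open import Data.Maybe using (Maybe; just; nothing)
open import Data.Integer using (+_)
open import Data.Rational using (ℚ; 0ℚ; 1ℚ; _+_; _*_; _-_; _÷_; _≤_; _<_; _/_; ≢-nonZero)
open import Data.Rational.Properties using (_≟_)
open import Data.Product using (Σ; ∃; ∃-syntax; _×_; _,_)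
open import Relation.Nullary using (¬_; yes; no)
open import Relation.Nullary.Decidable using (⌊_⌋)
open import Relation.Binary.PropositionalEquality using (_≡_; _≢_; refl)
open import Relation.Binary.Definitions using (DecidableEquality)

ℕ→ℚ : ℕ → ℚ
ℕ→ℚ n = + n / 1

-- division, returning 0 when the denominator is 0 (only used for
-- w(t) / Σ_{u∈C} w(u); such a situation never has positive probability mass
-- in the nets considered)
_÷?_ : ℚ → ℚ → ℚ
p ÷? q with q ≟ 0ℚ
... | yes _ = 0ℚ
... | no q≢0 = _÷_ p q {{≢-nonZero q≢0}}

sumℚ : {A : Set} → List A → (A → ℚ) → ℚ
sumℚ xs f = foldr (λ x acc → f x + acc) 0ℚ xs

prodℚ : {A : Set} → List A → (A → ℚ) → ℚ
prodℚ xs f = foldr (λ x acc → f x * acc) 1ℚ xs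

boolFilter : {A : Set} → (A → Bool) → List A → List A
boolFilter f [] = []
boolFilter f (x ∷ xs) = if f x then x ∷ boolFilter f xs else boolFilter f xs

bit : Bool → ℕ
bit true = 1
bit false = 0

-- Timed probabilistic workflow nets (TPWN), with finite place/transition
-- types given by complete duplicate-free enumerations.

record TPWN : Set₁ where
  field
    P T     : Set
    places  : List P
    trans   : List T
    _≟P_    : DecidableEquality P
    pre     : P → T → Bool
    post    : T → P → Bool
    i o     : P
    w       : T → ℚ
    τ       : T → ℕ

module Semantics (W : TPWN) where
  open TPWN W

  Marking : Set
  Marking = P → ℕ

  single : P → Marking
  single q p with p ≟P q
  ... | yes _ = 1
  ... | no  _ = 0

  𝐢 𝐨 : Marking
  𝐢 = single i
  𝐨 = single o

  isMarking : Marking → Marking → Bool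
  isMarking M M' = all (λ p → ⌊ M p ℕ.≟ M' p ⌋) places

  enabled : T → Marking → Bool
  enabled t M = all (λ q → not (pre q t) ∨ ⌊ 1 ℕ.≤? M q ⌋) places

  someEnabled : Marking → Bool
  someEnabled M = any (λ t → enabled t M) trans

  fire : Marking → T → Marking
  fire M t p = (M p ∸ bit (pre p t)) ℕ.+ bit (post t p)

  mark : List T → Marking
  mark σ = foldl fire 𝐢 σ

  inConflict : T → Marking → T → Bool
  inConflict t M u = enabled u M ∧ any (λ q → pre q t ∧ pre q u) places

  conflictSet : T → Marking → List T
  conflictSet t M = boolFilter (inConflict t M) trans

  -- Timing: ℕ⊥ is Maybe ℕ with nothing = ⊥
  max⊥ : Maybe ℕ → Maybe ℕ → Maybe ℕ
  max⊥ nothing y = y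
  max⊥ (just x) nothing = just x
  max⊥ (just x) (just y) = just (x ℕ.⊔ y)

  _+⊥_ : Maybe ℕ → ℕ → Maybe ℕ
  nothing +⊥ _ = nothing
  just x +⊥ n = just (x ℕ.+ n)

  TimeVec : Set
  TimeVec = P → Maybe ℕ

  upd : TimeVec → T → TimeVec
  upd x t p =
    if post t p
      then foldr max⊥ nothing (map x (boolFilter (λ q → pre q t) places)) +⊥ τ t
      else (if pre p t then nothing else x p)

  μ₀ : TimeVec
  μ₀ p with p ≟P i
  ... | yes _ = just 0
  ... | no  _ = nothing

  μ : List T → TimeVec
  μ σ = foldl upd μ₀ σ

  time⊥ : List T → Maybe ℕ
  time⊥ σ = foldr max⊥ nothing (map (μ σ) places)

  -- time as a rational (⊥ never occurs for sequences that reach 𝐨)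
  timeℚ : List T → ℚ
  timeℚ σ with time⊥ σ
  ... | just n  = ℕ→ℚ n
  ... | nothing = 0ℚ

  -- A path of the MDP from 𝐢
  -- is determined by the sequence of fired transitions; at a marking M the
  -- scheduler picks an enabled transition r, thereby choosing the
  -- distribution of the conflict set C(r,M) ∈ 𝒞(M).
  Scheduler : Set
  Scheduler = Σ (List T → T) λ S →
    ∀ σ → someEnabled (mark σ) ≡ true → enabled (S σ) (mark σ) ≡ true

  module _ (Sch : Scheduler) where
    S : List T → T
    S = Data.Product.proj₁ Sch

    stepProb : List T → T → ℚ
    stepProb σ t =
      let M = mark σ
          r = S σ
      in if inConflict r M t
           then w t ÷? sumℚ (conflictSet r M) w
           else 0ℚ

    probFrom : List T → List T → ℚ
    probFrom hist [] = 1ℚ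
    probFrom hist (t ∷ rest) = stepProb hist t * probFrom (hist ++ [ t ]) rest

    -- Prob^S of the cylinder of paths starting with the firing sequence σ
    prob : List T → ℚ
    prob σ = probFrom [] σ

    seqs : ℕ → List (List T)
    seqs zero = [ [] ]
    seqs (suc j) = concatMap (λ σ → map (λ t → σ ++ [ t ]) trans) (seqs j)

    isO : List T → Bool
    isO σ = isMarking (mark σ) 𝐨

    firstReach : List T → Bool
    firstReach σ = isO σ ∧ not (any isO (take (length σ) (inits σ)))

    reachedWithin : ℕ → List (List T)
    reachedWithin k = concatMap (λ j → boolFilter firstReach (seqs j)) (upTo (suc k))

    Preach : ℕ → ℚ
    Preach k = sumℚ (reachedWithin k) prob

    Etrunc : ℕ → ℚ
    Etrunc k = sumℚ (reachedWithin k) (λ σ → prob σ * timeℚ σ)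

  -- ET^S_W = c  (c ∈ ℚ, finite).  By monotone convergence this holds iff
  -- 𝐨 is visited with probability 1 and sup_k Etrunc k = c.
  ETIs : Scheduler → ℚ → Set
  ETIs Sch c =
      (∀ k → Etrunc Sch k ≤ c)
    × (∀ ε → 0ℚ < ε → ∃[ k ] (c - ε < Etrunc Sch k))
    × (∀ ε → 0ℚ < ε → ∃[ k ] (1ℚ - ε < Preach Sch k))

record PERT : Set where
  field
    n m   : ℕ
    src   : Fin m → Fin n
    tgt   : Fin m → Fin n
    s t   : Fin n
    p     : Fin m → ℚ

module PERTDefs (𝒫 : PERT) where
  open PERT 𝒫

  data Walk : Fin n → List (Fin m) → Fin n → Set where
    nil  : ∀ {v} → Walk v [] v
    cons : ∀ {e es v} → Walk (tgt e) es v → Walk (src e) (e ∷ es) v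

  record IsPERT : Set where
    field
      -- E is a set of pairs (no parallel edges)
      simple     : ∀ e e′ → src e ≡ src e′ → tgt e ≡ tgt e′ → e ≡ e′
      acyclic    : ∀ v e es → ¬ Walk v (e ∷ es) v
      s-source   : ∀ e → tgt e ≢ s
      s-unique   : ∀ v → v ≢ s → ∃[ e ] (tgt e ≡ v)
      t-sink     : ∀ e → src e ≢ t
      t-unique   : ∀ v → v ≢ t → ∃[ e ] (src e ≡ v)
      p-lower    : ∀ e → 0ℚ ≤ p e
      p-upper    : ∀ e → p e ≤ 1ℚ

  Outcome : Set
  Outcome = Fin m → Bool

  allOutcomes : (k : ℕ) → List (Fin k → Bool)
  allOutcomes zero = [ (λ ()) ]
  allOutcomes (suc k) =
    concatMap (λ f → (λ { Fin.zero → false ; (Fin.suc j) → f j })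
                   ∷ (λ { Fin.zero → true  ; (Fin.suc j) → f j }) ∷ [])
              (allOutcomes k)

  outcomeProb : Outcome → ℚ
  outcomeProb x = prodℚ (allFin m) (λ e → if x e then p e else 1ℚ - p e)

  pathLength : Outcome → List (Fin m) → ℕ
  pathLength x es = foldr (λ e acc → bit (x e) ℕ.+ acc) 0 es

  IsPD : Outcome → ℕ → Set
  IsPD x d = (∃[ es ] (Walk s es t × pathLength x es ≡ d))
           × (∀ es → Walk s es t → pathLength x es ℕ.≤ d)

  expectedPD : (Outcome → ℕ) → ℚ
  expectedPD f = sumℚ (allOutcomes m) (λ x → outcomeProb x * ℕ→ℚ (f x))

  data PlaceW : Set where
    pI pO : PlaceW
    pIn   : Fin m → PlaceW   -- [u,e]  for e = (u,v)
    pOut  : Fin m → PlaceW   -- [e,v]  for e = (u,v)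

  data TransW : Set where
    tE : Fin m → Bool → TransW   -- t_{e,0} (false), t_{e,1} (true)
    tV : Fin n → TransW

  _≟W_ : DecidableEquality PlaceW
  pI ≟W pI = yes refl
  pI ≟W pO = no λ ()
  pI ≟W pIn _ = no λ ()
  pI ≟W pOut _ = no λ ()
  pO ≟W pI = no λ ()
  pO ≟W pO = yes refl
  pO ≟W pIn _ = no λ ()
  pO ≟W pOut _ = no λ ()
  pIn _ ≟W pI = no λ ()
  pIn _ ≟W pO = no λ ()
  pIn e ≟W pIn e′ with e FinP.≟ e′
  ... | yes refl = yes refl
  ... | no ne = no λ { refl → ne refl }
  pIn _ ≟W pOut _ = no λ ()
  pOut _ ≟W pI = no λ ()
  pOut _ ≟W pO = no λ ()
  pOut _ ≟W pIn _ = no λ ()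
  pOut e ≟W pOut e′ with e FinP.≟ e′
  ... | yes refl = yes refl
  ... | no ne = no λ { refl → ne refl }

  _==_ : ∀ {k} → Fin k → Fin k → Bool
  a == b = ⌊ a FinP.≟ b ⌋

  preW : PlaceW → TransW → Bool
  preW pI (tV v) = v == s
  preW (pIn e) (tE e′ _) = e == e′
  preW (pOut e) (tV v) = tgt e == v
  preW _ _ = false

  postW : TransW → PlaceW → Bool
  postW (tE e _) (pOut e′) = e == e′
  postW (tV v) (pIn e) = src e == v
  postW (tV v) pO = v == t
  postW _ _ = false

  wW : TransW → ℚ
  wW (tE e false) = 1ℚ - p e
  wW (tE e true) = p e
  wW (tV _) = 1ℚ

  τW : TransW → ℕ
  τW (tE _ true) = 1
  τW (tE _ false) = 0
  τW (tV _) = 0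

  W𝒫 : TPWN
  W𝒫 = record
    { P = PlaceW
    ; T = TransW
    ; places = pI ∷ pO ∷ (map pIn (allFin m) ++ map pOut (allFin m))
    ; trans = map (λ e → tE e false) (allFin m) ++ map (λ e → tE e true) (allFin m)
              ++ map tV (allFin n)
    ; _≟P_ = _≟W_
    ; pre = preW
    ; post = postW
    ; i = pI
    ; o = pO
    ; w = wW
    ; τ = τW
    }

{-# OPTIONS --safe #-}
module Submission where

-- Firing t_v completes vertex v, and resolving the free choice between t_{e,0} and t_{e,1}
-- draws X_e.  Along every firing sequence the reachable markings are 1-safe and determined by
-- the vertices and edges fired so far, and the token on [u,e] carries the length of a longest
-- s–u path, the token on [e,v] that length plus X_e.  Each firing fires a new vertex or edge,
-- so every run deadlocks within |V| + |E| steps, and it deadlocks exactly in 𝐨, at time PD.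
--
-- For the probabilities, draw the whole outcome x = (X_e)_e in advance and let x resolve the
-- choices of the scheduler.  A run never inspects X_e before e fires, so by resampling X_e at
-- that moment the mass of each firing sequence equals the product-measure mass of the outcomes
-- that produce it.  Hence the expected time of reaching 𝐨 within k steps is 𝔼[PD · 1{run done by
-- step k}], which increases to 𝔼(PD), and is equal to it for k = |V| + |E|.

open import Defs
open import Data.Bool using (Bool; true; false; if_then_else_; _∧_; _∨_; not)
open import Data.Bool.ListAction using (all; any)
open import Data.Bool.Properties using (T-≡; ∨-identityʳ; ∨-zeroʳ; ∧-identityʳ; ∧-zeroʳ)
open import Data.Empty using (⊥; ⊥-elim)
open import Data.Fin using (Fin; zero; suc)
import Data.Fin.Properties as Fin
open import Data.List.Base using (List; []; _∷_; _++_; [_]; _∷ʳ_; map; concatMap; foldr; allFin; upTo; length; inits; take)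
open import Data.List.Membership.Propositional using (_∈_; lose; find)
open import Data.List.Membership.Propositional.Properties using (∈-allFin; ∈-map⁺; ∈-map⁻; ∈-++⁺ˡ; ∈-++⁺ʳ)
open import Data.List.Properties using (map-tabulate; length-tabulate; upTo-∷ʳ; foldl-∷ʳ; ++-identityʳ; ++-assoc; map-++; take-map)
import Data.List.Relation.Unary.All as All
open import Data.List.Relation.Unary.All.Properties using (all⁺; all⁻)
open import Data.List.Relation.Unary.Any using (here; there)
open import Data.List.Relation.Unary.Any.Properties using (any⁺; any⁻)
open import Data.Maybe using (Maybe; just; nothing)
open import Data.Nat as ℕ using (ℕ)
import Data.Nat.Properties as ℕ
open import Data.Product using (∃-syntax; _×_; _,_; proj₁; proj₂)
open import Data.Rational using (ℚ; 0ℚ; 1ℚ; _+_; _*_; _-_; -_; _≤_; _<_; nonNegative)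
import Data.Rational.Properties as ℚ
open import Data.Rational.Solver using (module +-*-Solver)
open import Data.Sum using (_⊎_; inj₁; inj₂)
open import Data.Unit using (⊤)
open import Data.Vec.Functional using (updateAt) renaming (_∷_ to _◂_)
open import Data.Vec.Functional.Properties using (updateAt-minimal; updateAt-updates)
open import Function using (_∘_; id; const; Equivalence)
open import Relation.Binary.PropositionalEquality hiding ([_])
open import Relation.Nullary using (¬_; Dec; yes; no)
open import Relation.Nullary.Decidable using (⌊_⌋; toWitness; fromWitness)

open Equivalence using (to; from)
open +-*-Solver

contraposeᵇ : ∀ {b c} → (b ≡ true → c ≡ true) → c ≡ false → b ≡ false
contraposeᵇ {false} b⇒c c≡false = refl
contraposeᵇ {true} b⇒c c≡false with () ← trans (sym (b⇒c refl)) c≡false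

not-antimono : ∀ {a b} → (a ≡ true → b ≡ true) → not b ≡ true → not a ≡ true
not-antimono {false} _ _ = refl
not-antimono {true} a⇒b ¬b with () ← trans (cong not (sym (a⇒b refl))) ¬b

∧-true : ∀ {a b} → a ∧ b ≡ true → a ≡ true × b ≡ true
∧-true {true} {true} _ = refl , refl

∨-false : ∀ {a b} → a ∨ b ≡ false → a ≡ false × b ≡ false
∨-false {false} {false} _ = refl , refl

∧-true-∨-false : ∀ a → a ≡ (a ∧ true) ∨ false
∧-true-∨-false true = refl
∧-true-∨-false false = refl

∧-not-∨ : ∀ a b c → a ∧ not (b ∨ c) ≡ ((a ∧ not b) ∧ not c) ∨ false
∧-not-∨ false b c = refl
∧-not-∨ true true c = refl
∧-not-∨ true false true = refl
∧-not-∨ true false false = refl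

∨-∧-true : ∀ a b → a ∨ b ≡ (a ∧ true) ∨ b
∨-∧-true true b = refl
∨-∧-true false b = refl

∨-false-∧ : ∀ a b → (a ∨ false) ∧ b ≡ ((a ∧ b) ∧ true) ∨ false
∨-false-∧ true b = ∧-true-∨-false b
∨-false-∧ false b = refl

module _ {A : Set} (P : A → Bool) where

  all-sound : ∀ xs {y} → all P xs ≡ true → y ∈ xs → P y ≡ true
  all-sound xs eq y∈ = to T-≡ (All.lookup (all⁺ P xs (from T-≡ eq)) y∈)

  all-complete : ∀ xs → (∀ y → P y ≡ true) → all P xs ≡ true
  all-complete xs P≡true = to T-≡ (all⁻ P {xs} (All.tabulate λ {y} _ → from T-≡ (P≡true y)))

  all-false : ∀ xs → all P xs ≡ false → ∃[ y ] (P y ≡ false)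
  all-false (x ∷ xs) eq with P x in Px
  ... | true = all-false xs eq
  ... | false = x , Px

  any-sound : ∀ xs → any P xs ≡ true → ∃[ y ] (y ∈ xs × P y ≡ true)
  any-sound xs eq with find (any⁻ P xs (from T-≡ eq))
  ... | y , y∈ , Py = y , y∈ , to T-≡ Py

  any-complete : ∀ xs {y} → y ∈ xs → P y ≡ true → any P xs ≡ true
  any-complete xs y∈ Py = to T-≡ (any⁺ P (lose y∈ (from T-≡ Py)))

  any-false : ∀ xs → (∀ y → y ∈ xs → P y ≡ false) → any P xs ≡ false
  any-false [] _ = refl
  any-false (x ∷ xs) P≡false rewrite P≡false x (here refl) = any-false xs λ y y∈ → P≡false y (there y∈)

  any-false-sound : ∀ xs {y} → any P xs ≡ false → y ∈ xs → P y ≡ false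
  any-false-sound (x ∷ xs) eq (here refl) with P x
  ... | false = refl
  any-false-sound (x ∷ xs) eq (there y∈) with P x
  ... | false = any-false-sound xs eq y∈

  any-∷ʳ : ∀ xs y → any P (xs ∷ʳ y) ≡ any P xs ∨ P y
  any-∷ʳ [] y = ∨-identityʳ (P y)
  any-∷ʳ (x ∷ xs) y with P x
  ... | true = refl
  ... | false = any-∷ʳ xs y

  any-∷ʳ⁺ : ∀ xs y → any P xs ≡ true → any P (xs ∷ʳ y) ≡ true
  any-∷ʳ⁺ xs y eq = trans (any-∷ʳ xs y) (cong (_∨ P y) eq)

  countᵇ : List A → ℕ
  countᵇ [] = 0
  countᵇ (x ∷ xs) = bit (P x) ℕ.+ countᵇ xs

  countᵇ≤length : ∀ xs → countᵇ xs ℕ.≤ length xs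
  countᵇ≤length [] = ℕ.z≤n
  countᵇ≤length (x ∷ xs) with P x
  ... | true = ℕ.s≤s (countᵇ≤length xs)
  ... | false = ℕ.m≤n⇒m≤1+n (countᵇ≤length xs)

module _ {A B : Set} (f : A → B) (P : A → Bool) where

  ∈-map-boolFilter⁻ : ∀ xs {y} → y ∈ map f (boolFilter P xs) → ∃[ x ] (P x ≡ true × y ≡ f x)
  ∈-map-boolFilter⁻ (x ∷ xs) y∈ with P x in Px
  ∈-map-boolFilter⁻ (x ∷ xs) (here refl) | true = x , Px , refl
  ∈-map-boolFilter⁻ (x ∷ xs) (there y∈) | true = ∈-map-boolFilter⁻ xs y∈
  ∈-map-boolFilter⁻ (x ∷ xs) y∈ | false = ∈-map-boolFilter⁻ xs y∈

  ∈-map-boolFilter⁺ : ∀ xs {x} → x ∈ xs → P x ≡ true → f x ∈ map f (boolFilter P xs)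
  ∈-map-boolFilter⁺ (x ∷ xs) (here refl) Px rewrite Px = here refl
  ∈-map-boolFilter⁺ (x′ ∷ xs) (there x∈) Px with P x′
  ... | true = there (∈-map-boolFilter⁺ xs x∈ Px)
  ... | false = ∈-map-boolFilter⁺ xs x∈ Px

countᵇ-mono : ∀ {A : Set} (P Q : A → Bool) xs → (∀ y → Q y ≡ true → P y ≡ true) → countᵇ Q xs ℕ.≤ countᵇ P xs
countᵇ-mono P Q [] Q⇒P = ℕ.z≤n
countᵇ-mono P Q (x ∷ xs) Q⇒P with Q x in Qx | P x in Px
... | true | true = ℕ.s≤s (countᵇ-mono P Q xs Q⇒P)
... | true | false with () ← trans (sym (Q⇒P x Qx)) Px
... | false | true = ℕ.m≤n⇒m≤1+n (countᵇ-mono P Q xs Q⇒P)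
... | false | false = countᵇ-mono P Q xs Q⇒P

countᵇ-mono-< : ∀ {A : Set} (P Q : A → Bool) xs {z} → (∀ y → Q y ≡ true → P y ≡ true) →
  z ∈ xs → P z ≡ true → Q z ≡ false → countᵇ Q xs ℕ.< countᵇ P xs
countᵇ-mono-< P Q (x ∷ xs) Q⇒P (here refl) Pz Qz rewrite Pz | Qz = ℕ.s≤s (countᵇ-mono P Q xs Q⇒P)
countᵇ-mono-< P Q (x ∷ xs) Q⇒P (there z∈) Pz Qz with Q x in Qx | P x in Px
... | true | true = ℕ.s≤s (countᵇ-mono-< P Q xs Q⇒P z∈ Pz Qz)
... | true | false with () ← trans (sym (Q⇒P x Qx)) Px
... | false | true = ℕ.m≤n⇒m≤1+n (countᵇ-mono-< P Q xs Q⇒P z∈ Pz Qz)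
... | false | false = countᵇ-mono-< P Q xs Q⇒P z∈ Pz Qz

countᵇ-allFin≤ : ∀ {k} (P : Fin k → Bool) → countᵇ P (allFin k) ℕ.≤ k
countᵇ-allFin≤ {k} P = ℕ.≤-trans (countᵇ≤length P (allFin k)) (ℕ.≤-reflexive (length-tabulate id))

inits-∷ʳ : ∀ {A : Set} (xs : List A) a → inits (xs ∷ʳ a) ≡ inits xs ∷ʳ (xs ∷ʳ a)
inits-∷ʳ [] a = refl
inits-∷ʳ (y ∷ xs) a = cong ([] ∷_) (trans (cong (map (y ∷_)) (inits-∷ʳ xs a)) (map-++ (y ∷_) (inits xs) _))

take-length-inits-∷ʳ : ∀ {A : Set} (xs : List A) a → take (length (xs ∷ʳ a)) (inits (xs ∷ʳ a)) ≡ inits xs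
take-length-inits-∷ʳ [] a = refl
take-length-inits-∷ʳ (y ∷ xs) a =
  cong ([] ∷_) (trans (take-map (length (xs ∷ʳ a)) (inits (xs ∷ʳ a))) (cong (map (y ∷_)) (take-length-inits-∷ʳ xs a)))

module _ {A : Set} where

  sumℚ-++ : ∀ (xs ys : List A) f → sumℚ (xs ++ ys) f ≡ sumℚ xs f + sumℚ ys f
  sumℚ-++ [] ys f = sym (ℚ.+-identityˡ _)
  sumℚ-++ (x ∷ xs) ys f = trans (cong (f x +_) (sumℚ-++ xs ys f)) (sym (ℚ.+-assoc (f x) _ _))

  sumℚ-cong : ∀ (xs : List A) {f g} → f ≗ g → sumℚ xs f ≡ sumℚ xs g
  sumℚ-cong [] f≗g = refl
  sumℚ-cong (x ∷ xs) f≗g = cong₂ _+_ (f≗g x) (sumℚ-cong xs f≗g)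

  sumℚ-zero : ∀ (xs : List A) {f} → f ≗ const 0ℚ → sumℚ xs f ≡ 0ℚ
  sumℚ-zero [] f≗0 = refl
  sumℚ-zero (x ∷ xs) f≗0 = cong₂ _+_ (f≗0 x) (sumℚ-zero xs f≗0)

  sumℚ-+ : ∀ (xs : List A) f g → sumℚ xs (λ x → f x + g x) ≡ sumℚ xs f + sumℚ xs g
  sumℚ-+ [] f g = refl
  sumℚ-+ (x ∷ xs) f g = trans (cong ((f x + g x) +_) (sumℚ-+ xs f g))
    (solve 4 (λ a b c d → (a :+ b) :+ (c :+ d) := (a :+ c) :+ (b :+ d)) refl (f x) (g x) (sumℚ xs f) (sumℚ xs g))

  sumℚ-*ˡ : ∀ (xs : List A) a f → sumℚ xs (λ x → a * f x) ≡ a * sumℚ xs f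
  sumℚ-*ˡ [] a f = sym (ℚ.*-zeroʳ a)
  sumℚ-*ˡ (x ∷ xs) a f = trans (cong (a * f x +_) (sumℚ-*ˡ xs a f)) (sym (ℚ.*-distribˡ-+ a (f x) _))

  sumℚ-boolFilter : ∀ (xs : List A) P f → sumℚ (boolFilter P xs) f ≡ sumℚ xs (λ x → if P x then f x else 0ℚ)
  sumℚ-boolFilter [] P f = refl
  sumℚ-boolFilter (x ∷ xs) P f with P x
  ... | true = cong (f x +_) (sumℚ-boolFilter xs P f)
  ... | false = trans (sumℚ-boolFilter xs P f) (sym (ℚ.+-identityˡ _))

  prodℚ-cong : ∀ (xs : List A) {f g} → f ≗ g → prodℚ xs f ≡ prodℚ xs g
  prodℚ-cong [] f≗g = refl
  prodℚ-cong (x ∷ xs) f≗g = cong₂ _*_ (f≗g x) (prodℚ-cong xs f≗g)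

  sumℚ-mono : ∀ (xs : List A) {f g} → (∀ x → f x ≤ g x) → sumℚ xs f ≤ sumℚ xs g
  sumℚ-mono [] f≤g = ℚ.≤-refl
  sumℚ-mono (x ∷ xs) f≤g = ℚ.+-mono-≤ (f≤g x) (sumℚ-mono xs f≤g)

module _ {A B : Set} where

  sumℚ-map : ∀ (g : A → B) xs f → sumℚ (map g xs) f ≡ sumℚ xs (f ∘ g)
  sumℚ-map g [] f = refl
  sumℚ-map g (x ∷ xs) f = cong (f (g x) +_) (sumℚ-map g xs f)

  sumℚ-concatMap : ∀ (g : A → List B) xs f → sumℚ (concatMap g xs) f ≡ sumℚ xs (λ x → sumℚ (g x) f)
  sumℚ-concatMap g [] f = refl
  sumℚ-concatMap g (x ∷ xs) f = trans (sumℚ-++ (g x) (concatMap g xs) f) (cong (sumℚ (g x) f +_) (sumℚ-concatMap g xs f))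

  sumℚ-comm : ∀ (xs : List A) (ys : List B) (F : A → B → ℚ) →
    sumℚ xs (λ x → sumℚ ys (F x)) ≡ sumℚ ys (λ y → sumℚ xs (λ x → F x y))
  sumℚ-comm [] ys F = sym (sumℚ-zero ys (λ _ → refl))
  sumℚ-comm (x ∷ xs) ys F = trans (cong (sumℚ ys (F x) +_) (sumℚ-comm xs ys F))
    (sym (sumℚ-+ ys (F x) (λ y → sumℚ xs (λ x′ → F x′ y))))

sumℚ-allFin-suc : ∀ k (F : Fin (ℕ.suc k) → ℚ) → sumℚ (allFin (ℕ.suc k)) F ≡ F zero + sumℚ (allFin k) (F ∘ suc)
sumℚ-allFin-suc k F = cong (F zero +_) (trans (cong (λ xs → sumℚ xs F) (sym (map-tabulate id suc))) (sumℚ-map suc (allFin k) F))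

prodℚ-allFin-suc : ∀ k (F : Fin (ℕ.suc k) → ℚ) → prodℚ (allFin (ℕ.suc k)) F ≡ F zero * prodℚ (allFin k) (F ∘ suc)
prodℚ-allFin-suc k F = cong (F zero *_) (trans (cong (λ xs → prodℚ xs F) (sym (map-tabulate id suc))) (prodℚ-map (allFin k)))
  where
  prodℚ-map : ∀ xs → prodℚ (map suc xs) F ≡ prodℚ xs (F ∘ suc)
  prodℚ-map [] = refl
  prodℚ-map (x ∷ xs) = cong (F (suc x) *_) (prodℚ-map xs)

sumℚ-allFin-single : ∀ k (F : Fin k → ℚ) e → (∀ e′ → e′ ≢ e → F e′ ≡ 0ℚ) → sumℚ (allFin k) F ≡ F e
sumℚ-allFin-single (ℕ.suc k) F zero F≡0 = begin
  sumℚ (allFin (ℕ.suc k)) F            ≡⟨ sumℚ-allFin-suc k F ⟩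
  F zero + sumℚ (allFin k) (F ∘ suc)   ≡⟨ cong (F zero +_) (sumℚ-zero (allFin k) (λ e′ → F≡0 (suc e′) λ ())) ⟩
  F zero + 0ℚ                          ≡⟨ ℚ.+-identityʳ _ ⟩
  F zero                               ∎
  where open ≡-Reasoning
sumℚ-allFin-single (ℕ.suc k) F (suc e) F≡0 = begin
  sumℚ (allFin (ℕ.suc k)) F            ≡⟨ sumℚ-allFin-suc k F ⟩
  F zero + sumℚ (allFin k) (F ∘ suc)   ≡⟨ cong₂ _+_ (F≡0 zero λ ())
                                            (sumℚ-allFin-single k (F ∘ suc) e λ e′ e′≢e → F≡0 (suc e′) (e′≢e ∘ Fin.suc-injective)) ⟩
  0ℚ + F (suc e)                       ≡⟨ ℚ.+-identityˡ _ ⟩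
  F (suc e)                            ∎
  where open ≡-Reasoning

sumℚ-upTo-telescope : ∀ n (a : ℕ → ℚ) → sumℚ (upTo n) (λ j → a j - a (ℕ.suc j)) ≡ a 0 - a n
sumℚ-upTo-telescope ℕ.zero a = solve 1 (λ x → con 0ℚ := x :- x) refl (a 0)
sumℚ-upTo-telescope (ℕ.suc n) a = begin
  sumℚ (upTo (ℕ.suc n)) d                  ≡⟨ cong (λ js → sumℚ js d) (sym (upTo-∷ʳ n)) ⟩
  sumℚ (upTo n ∷ʳ n) d                     ≡⟨ sumℚ-++ (upTo n) [ n ] d ⟩
  sumℚ (upTo n) d + (d n + 0ℚ)             ≡⟨ cong (_+ (d n + 0ℚ)) (sumℚ-upTo-telescope n a) ⟩
  (a 0 - a n) + ((a n - a (ℕ.suc n)) + 0ℚ) ≡⟨ solve 3 (λ x y z → (x :- y) :+ ((y :- z) :+ con 0ℚ) := x :- z)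
                                                      refl (a 0) (a n) (a (ℕ.suc n)) ⟩
  a 0 - a (ℕ.suc n)                        ∎
  where
  open ≡-Reasoning
  d : ℕ → ℚ
  d j = a j - a (ℕ.suc j)

if-linear : ∀ c a b u v → a * (if c then u else 0ℚ) + b * (if c then v else 0ℚ) ≡ (if c then a * u + b * v else 0ℚ)
if-linear true a b u v = refl
if-linear false a b u v = trans (cong₂ _+_ (ℚ.*-zeroʳ a) (ℚ.*-zeroʳ b)) (ℚ.+-identityˡ 0ℚ)

[_]ℚ : Bool → ℚ
[ true ]ℚ = 1ℚ
[ false ]ℚ = 0ℚ

ℕ→ℚ-nonneg : ∀ d → 0ℚ ≤ ℕ→ℚ d
ℕ→ℚ-nonneg d = ℚ.nonNegative⁻¹ (ℕ→ℚ d) {{ℚ.normalize-nonNeg d 1}}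

p-q<p : ∀ p q → 0ℚ < q → p - q < p
p-q<p p q 0<q = subst (p - q <_) (ℚ.+-identityʳ p) (ℚ.+-monoʳ-< p (ℚ.neg-antimono-< 0<q))

-- allOutcomes is defined inside PERTDefs but does not depend on the network.
module Expectation (𝒫 : PERT) where
  open PERTDefs 𝒫 using (allOutcomes)

  weight : ∀ {k} → (Fin k → ℚ) → (Fin k → Bool) → ℚ
  weight q x = prodℚ (allFin _) (λ e → if x e then q e else 1ℚ - q e)

  𝔼 : ∀ {k} → (Fin k → ℚ) → ((Fin k → Bool) → ℚ) → ℚ
  𝔼 q G = sumℚ (allOutcomes _) (λ x → weight q x * G x)

  -- Needed because allOutcomes builds its own functions and there is no function extensionality.
  Extensional : ∀ {k} → ((Fin k → Bool) → ℚ) → Set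
  Extensional G = ∀ {x y} → x ≗ y → G x ≡ G y

  weight-ext : ∀ {k} (q : Fin k → ℚ) → Extensional (weight q)
  weight-ext q x≗y = prodℚ-cong (allFin _) λ e → cong (λ b → if b then q e else 1ℚ - q e) (x≗y e)

  𝔼-cong : ∀ {k} (q : Fin k → ℚ) {G H} → G ≗ H → 𝔼 q G ≡ 𝔼 q H
  𝔼-cong {k} q G≗H = sumℚ-cong (allOutcomes k) λ x → cong (weight q x *_) (G≗H x)

  𝔼-+ : ∀ {k} (q : Fin k → ℚ) G H → 𝔼 q (λ x → G x + H x) ≡ 𝔼 q G + 𝔼 q H
  𝔼-+ {k} q G H = trans (sumℚ-cong (allOutcomes k) λ x → ℚ.*-distribˡ-+ (weight q x) (G x) (H x))
                        (sumℚ-+ (allOutcomes k) (λ x → weight q x * G x) (λ x → weight q x * H x))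

  𝔼-*ˡ : ∀ {k} (q : Fin k → ℚ) a G → 𝔼 q (λ x → a * G x) ≡ a * 𝔼 q G
  𝔼-*ˡ {k} q a G = trans (sumℚ-cong (allOutcomes k) λ x → solve 3 (λ w a g → w :* (a :* g) := a :* (w :* g)) refl (weight q x) a (G x))
                         (sumℚ-*ˡ (allOutcomes k) a (λ x → weight q x * G x))

  𝔼-sumℚ : ∀ {k} {A : Set} (q : Fin k → ℚ) (xs : List A) (G : A → (Fin k → Bool) → ℚ) →
    𝔼 q (λ x → sumℚ xs (λ a → G a x)) ≡ sumℚ xs (λ a → 𝔼 q (G a))
  𝔼-sumℚ {k} q xs G = begin
    sumℚ (allOutcomes k) (λ x → weight q x * sumℚ xs (λ a → G a x))
      ≡⟨ sumℚ-cong (allOutcomes k) (λ x → sym (sumℚ-*ˡ xs (weight q x) (λ a → G a x))) ⟩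
    sumℚ (allOutcomes k) (λ x → sumℚ xs (λ a → weight q x * G a x))
      ≡⟨ sumℚ-comm (allOutcomes k) xs (λ x a → weight q x * G a x) ⟩
    sumℚ xs (λ a → 𝔼 q (G a))
      ∎
    where open ≡-Reasoning

  weight-nonneg : ∀ {k} (q : Fin k → ℚ) → (∀ e → 0ℚ ≤ q e) → (∀ e → q e ≤ 1ℚ) → ∀ x → 0ℚ ≤ weight q x
  weight-nonneg {k} q 0≤q q≤1 x = prodℚ-nonneg (allFin k)
    where
    0≤1-q : ∀ e → 0ℚ ≤ 1ℚ - q e
    0≤1-q e = subst (_≤ 1ℚ - q e) (ℚ.+-inverseʳ (q e)) (ℚ.+-monoˡ-≤ (- q e) (q≤1 e))
    factor : Fin k → ℚ
    factor e = if x e then q e else 1ℚ - q e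
    0≤factor : ∀ e → 0ℚ ≤ factor e
    0≤factor e with x e
    ... | true = 0≤q e
    ... | false = 0≤1-q e
    prodℚ-nonneg : ∀ es → 0ℚ ≤ prodℚ es factor
    prodℚ-nonneg [] = ℚ.<⇒≤ (ℚ.positive⁻¹ 1ℚ)
    prodℚ-nonneg (e ∷ es) = ℚ.nonNegative⁻¹ _
      {{ℚ.nonNeg*nonNeg⇒nonNeg (factor e) {{nonNegative (0≤factor e)}} (prodℚ es factor) {{nonNegative (prodℚ-nonneg es)}}}}

  𝔼-mono : ∀ {k} (q : Fin k → ℚ) → (∀ e → 0ℚ ≤ q e) → (∀ e → q e ≤ 1ℚ) →
    ∀ {G H} → (∀ x → G x ≤ H x) → 𝔼 q G ≤ 𝔼 q H
  𝔼-mono {k} q 0≤q q≤1 G≤H = sumℚ-mono (allOutcomes k) λ x →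
    ℚ.*-monoˡ-≤-nonNeg (weight q x) {{nonNegative (weight-nonneg q 0≤q q≤1 x)}} (G≤H x)

  sumℚ-allOutcomes-suc : ∀ k (F : (Fin (ℕ.suc k) → Bool) → ℚ) → Extensional F →
    sumℚ (allOutcomes (ℕ.suc k)) F ≡ sumℚ (allOutcomes k) (λ f → F (false ◂ f) + F (true ◂ f))
  sumℚ-allOutcomes-suc k F F-ext = trans (sumℚ-concatMap _ (allOutcomes k) F) (sumℚ-cong (allOutcomes k) λ f →
    cong₂ _+_ (F-ext λ { zero → refl ; (suc j) → refl })
              (trans (ℚ.+-identityʳ _) (F-ext λ { zero → refl ; (suc j) → refl })))

  weight-◂ : ∀ {k} (q : Fin (ℕ.suc k) → ℚ) b f →
    weight q (b ◂ f) ≡ (if b then q zero else 1ℚ - q zero) * weight (q ∘ suc) f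
  weight-◂ {k} q b f = prodℚ-allFin-suc k (λ e → if (b ◂ f) e then q e else 1ℚ - q e)

  𝔼-suc : ∀ {k} (q : Fin (ℕ.suc k) → ℚ) G → Extensional G →
    𝔼 q G ≡ (1ℚ - q zero) * 𝔼 (q ∘ suc) (G ∘ (false ◂_)) + q zero * 𝔼 (q ∘ suc) (G ∘ (true ◂_))
  𝔼-suc {k} q G G-ext = begin
    𝔼 q G
      ≡⟨ sumℚ-allOutcomes-suc k _ (λ x≗y → cong₂ _*_ (weight-ext q x≗y) (G-ext x≗y)) ⟩
    sumℚ (allOutcomes k) (λ f → weighted false f + weighted true f)
      ≡⟨ sumℚ-cong (allOutcomes k) (λ f → cong₂ _+_ (split false f) (split true f)) ⟩
    sumℚ (allOutcomes k) (λ f → (1ℚ - q zero) * H false f + q zero * H true f)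
      ≡⟨ sumℚ-+ (allOutcomes k) (λ f → (1ℚ - q zero) * H false f) (λ f → q zero * H true f) ⟩
    sumℚ (allOutcomes k) (λ f → (1ℚ - q zero) * H false f) + sumℚ (allOutcomes k) (λ f → q zero * H true f)
      ≡⟨ cong₂ _+_ (sumℚ-*ˡ (allOutcomes k) (1ℚ - q zero) (H false)) (sumℚ-*ˡ (allOutcomes k) (q zero) (H true)) ⟩
    (1ℚ - q zero) * 𝔼 (q ∘ suc) (G ∘ (false ◂_)) + q zero * 𝔼 (q ∘ suc) (G ∘ (true ◂_))
      ∎
    where
    open ≡-Reasoning
    weighted H : Bool → (Fin k → Bool) → ℚ
    weighted b f = weight q (b ◂ f) * G (b ◂ f)
    H b f = weight (q ∘ suc) f * G (b ◂ f)
    split : ∀ b f → weighted b f ≡ (if b then q zero else 1ℚ - q zero) * H b f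
    split b f = trans (cong (_* G (b ◂ f)) (weight-◂ q b f))
                      (ℚ.*-assoc (if b then q zero else 1ℚ - q zero) (weight (q ∘ suc) f) (G (b ◂ f)))

  𝔼-const : ∀ k (q : Fin k → ℚ) c → 𝔼 q (const c) ≡ c
  𝔼-const ℕ.zero q c = trans (ℚ.+-identityʳ _) (ℚ.*-identityˡ c)
  𝔼-const (ℕ.suc k) q c = begin
    𝔼 q (const c)
      ≡⟨ 𝔼-suc q (const c) (λ _ → refl) ⟩
    (1ℚ - q zero) * 𝔼 (q ∘ suc) (const c) + q zero * 𝔼 (q ∘ suc) (const c)
      ≡⟨ cong₂ (λ u v → (1ℚ - q zero) * u + q zero * v) (𝔼-const k _ c) (𝔼-const k _ c) ⟩
    (1ℚ - q zero) * c + q zero * c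
      ≡⟨ solve 2 (λ a c → (con 1ℚ :- a) :* c :+ a :* c := c) refl (q zero) c ⟩
    c
      ∎
    where open ≡-Reasoning

  _[_]≔_ : ∀ {k} → (Fin k → Bool) → Fin k → Bool → Fin k → Bool
  x [ e ]≔ b = updateAt x e (const b)

  []≔-cong : ∀ {k} {x y : Fin k → Bool} e b → x ≗ y → x [ e ]≔ b ≗ y [ e ]≔ b
  []≔-cong zero b x≗y zero = refl
  []≔-cong zero b x≗y (suc j) = x≗y (suc j)
  []≔-cong (suc e) b x≗y zero = x≗y zero
  []≔-cong (suc e) b x≗y (suc j) = []≔-cong e b (x≗y ∘ suc) j

  []≔-restore : ∀ {k} (x : Fin k → Bool) e b → (x [ e ]≔ b) [ e ]≔ x e ≗ x
  []≔-restore x zero b zero = refl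
  []≔-restore x zero b (suc j) = refl
  []≔-restore x (suc e) b zero = refl
  []≔-restore x (suc e) b (suc j) = []≔-restore (x ∘ suc) e b j

  resampled : ∀ {k} → (Fin k → ℚ) → Fin k → ((Fin k → Bool) → ℚ) → (Fin k → Bool) → ℚ
  resampled q e G x = q e * G (x [ e ]≔ true) + (1ℚ - q e) * G (x [ e ]≔ false)

  resampled-ext : ∀ {k} (q : Fin k → ℚ) e {G} → Extensional G → Extensional (resampled q e G)
  resampled-ext q e G-ext x≗y =
    cong₂ (λ u v → q e * u + (1ℚ - q e) * v) (G-ext ([]≔-cong e true x≗y)) (G-ext ([]≔-cong e false x≗y))

  𝔼-resampled : ∀ {k} (q : Fin k → ℚ) e G → Extensional G → 𝔼 q G ≡ 𝔼 q (resampled q e G)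
  𝔼-resampled {ℕ.suc k} q zero G G-ext = begin
    𝔼 q G
      ≡⟨ 𝔼-suc q G G-ext ⟩
    (1ℚ - a) * 𝔼 q′ G₀ + a * 𝔼 q′ G₁
      ≡⟨ solve 3 (λ a u v → (con 1ℚ :- a) :* u :+ a :* v
                            := (con 1ℚ :- a) :* (a :* v :+ (con 1ℚ :- a) :* u) :+ a :* (a :* v :+ (con 1ℚ :- a) :* u))
                 refl a (𝔼 q′ G₀) (𝔼 q′ G₁) ⟩
    (1ℚ - a) * (a * 𝔼 q′ G₁ + (1ℚ - a) * 𝔼 q′ G₀) + a * (a * 𝔼 q′ G₁ + (1ℚ - a) * 𝔼 q′ G₀)
      ≡⟨ cong (λ u → (1ℚ - a) * u + a * u) (sym 𝔼-average) ⟩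
    (1ℚ - a) * 𝔼 q′ average + a * 𝔼 q′ average
      ≡⟨ cong₂ (λ u v → (1ℚ - a) * u + a * v) (𝔼-cong q′ (resampled-◂ false)) (𝔼-cong q′ (resampled-◂ true)) ⟩
    (1ℚ - a) * 𝔼 q′ (resampled q zero G ∘ (false ◂_)) + a * 𝔼 q′ (resampled q zero G ∘ (true ◂_))
      ≡⟨ sym (𝔼-suc q _ (resampled-ext q zero G-ext)) ⟩
    𝔼 q (resampled q zero G)
      ∎
    where
    open ≡-Reasoning
    a : ℚ
    a = q zero
    q′ : Fin k → ℚ
    q′ = q ∘ suc
    G₀ G₁ : (Fin k → Bool) → ℚ
    G₀ = G ∘ (false ◂_)
    G₁ = G ∘ (true ◂_)
    average : (Fin k → Bool) → ℚ
    average f = a * G₁ f + (1ℚ - a) * G₀ f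
    𝔼-average : 𝔼 q′ average ≡ a * 𝔼 q′ G₁ + (1ℚ - a) * 𝔼 q′ G₀
    𝔼-average = trans (𝔼-+ q′ _ _) (cong₂ _+_ (𝔼-*ˡ q′ a G₁) (𝔼-*ˡ q′ (1ℚ - a) G₀))
    resampled-◂ : ∀ b → average ≗ resampled q zero G ∘ (b ◂_)
    resampled-◂ b f = cong₂ (λ u v → a * u + (1ℚ - a) * v)
      (G-ext λ { zero → refl ; (suc j) → refl }) (G-ext λ { zero → refl ; (suc j) → refl })
  𝔼-resampled {ℕ.suc k} q (suc e) G G-ext = begin
    𝔼 q G
      ≡⟨ 𝔼-suc q G G-ext ⟩
    (1ℚ - a) * 𝔼 q′ (G ∘ (false ◂_)) + a * 𝔼 q′ (G ∘ (true ◂_))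
      ≡⟨ cong₂ (λ u v → (1ℚ - a) * u + a * v) (𝔼-resampled q′ e _ (G-ext ∘ ◂-cong false))
                                               (𝔼-resampled q′ e _ (G-ext ∘ ◂-cong true)) ⟩
    (1ℚ - a) * 𝔼 q′ (resampled q′ e (G ∘ (false ◂_))) + a * 𝔼 q′ (resampled q′ e (G ∘ (true ◂_)))
      ≡⟨ cong₂ (λ u v → (1ℚ - a) * u + a * v) (𝔼-cong q′ (resampled-◂ false)) (𝔼-cong q′ (resampled-◂ true)) ⟩
    (1ℚ - a) * 𝔼 q′ (resampled q (suc e) G ∘ (false ◂_)) + a * 𝔼 q′ (resampled q (suc e) G ∘ (true ◂_))
      ≡⟨ sym (𝔼-suc q _ (resampled-ext q (suc e) G-ext)) ⟩
    𝔼 q (resampled q (suc e) G)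
      ∎
    where
    open ≡-Reasoning
    a : ℚ
    a = q zero
    q′ : Fin k → ℚ
    q′ = q ∘ suc
    ◂-cong : ∀ b {f g : Fin k → Bool} → f ≗ g → (b ◂ f) ≗ (b ◂ g)
    ◂-cong b f≗g zero = refl
    ◂-cong b f≗g (suc j) = f≗g j
    resampled-◂ : ∀ b → resampled q′ e (G ∘ (b ◂_)) ≗ resampled q (suc e) G ∘ (b ◂_)
    resampled-◂ b f = cong₂ (λ u v → q′ e * u + (1ℚ - q′ e) * v)
      (G-ext λ { zero → refl ; (suc j) → refl }) (G-ext λ { zero → refl ; (suc j) → refl })

module Paths (𝒫 : PERT) where
  open PERT 𝒫
  open PERTDefs 𝒫

  ==-refl : ∀ {k} (a : Fin k) → (a == a) ≡ true
  ==-refl a with a Fin.≟ a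
  ... | yes _ = refl
  ... | no a≢a = ⊥-elim (a≢a refl)

  ==⇒≡ : ∀ {k} {a b : Fin k} → (a == b) ≡ true → a ≡ b
  ==⇒≡ {a = a} {b} eq with a Fin.≟ b
  ... | yes a≡b = a≡b

  ==-sym : ∀ {k} (a b : Fin k) → (a == b) ≡ (b == a)
  ==-sym a b with a Fin.≟ b | b Fin.≟ a
  ... | yes _ | yes _ = refl
  ... | no _ | no _ = refl
  ... | yes a≡b | no b≢a = ⊥-elim (b≢a (sym a≡b))
  ... | no a≢b | yes b≡a = ⊥-elim (a≢b (sym b≡a))

  ==-false⇒≢ : ∀ {k} {a b : Fin k} → (a == b) ≡ false → a ≢ b
  ==-false⇒≢ {a = a} a≠b refl with () ← trans (sym (==-refl a)) a≠b

  ≢⇒==-false : ∀ {k} {a b : Fin k} → a ≢ b → (a == b) ≡ false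
  ≢⇒==-false {a = a} {b} a≢b with a Fin.≟ b
  ... | yes a≡b = ⊥-elim (a≢b a≡b)
  ... | no _ = refl

  ==-∧-== : ∀ {k} {a b : Fin k} c → (a == b) ≡ false → (c == a) ∧ (c == b) ≡ false
  ==-∧-== {a = a} {b} c a≠b with c Fin.≟ a | c Fin.≟ b
  ... | yes refl | yes refl = trans (sym (==-refl c)) a≠b
  ... | yes _ | no _ = refl
  ... | no _ | _ = refl

  walk-∷ʳ : ∀ {u es e} → Walk u es (src e) → Walk u (es ∷ʳ e) (tgt e)
  walk-∷ʳ nil = cons nil
  walk-∷ʳ (cons w) = cons (walk-∷ʳ w)

  walk-[] : ∀ {u v} → Walk u [] v → u ≡ v
  walk-[] nil = refl

  walk-last : ∀ {u e es v} → Walk u (e ∷ es) v →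
    ∃[ es′ ] ∃[ e′ ] (e ∷ es ≡ es′ ∷ʳ e′ × Walk u es′ (src e′) × tgt e′ ≡ v)
  walk-last {e = e} {es = []} (cons nil) = [] , e , refl , nil , refl
  walk-last {e = e} {es = _ ∷ _} (cons w) with walk-last w
  ... | es′ , e′ , eq , w′ , tgt≡v = e ∷ es′ , e′ , cong (e ∷_) eq , cons w′ , tgt≡v

  pathLength-∷ʳ : ∀ x es e → pathLength x (es ∷ʳ e) ≡ pathLength x es ℕ.+ bit (x e)
  pathLength-∷ʳ x [] e = ℕ.+-identityʳ (bit (x e))
  pathLength-∷ʳ x (e′ ∷ es) e = trans (cong (bit (x e′) ℕ.+_) (pathLength-∷ʳ x es e)) (sym (ℕ.+-assoc (bit (x e′)) _ _))

  LongestPath : Outcome → Fin n → ℕ → Set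
  LongestPath x v d = (∃[ es ] (Walk s es v × pathLength x es ≡ d)) × (∀ es → Walk s es v → pathLength x es ℕ.≤ d)

  longestPath-unique : ∀ {x v d d′} → LongestPath x v d → LongestPath x v d′ → d ≡ d′
  longestPath-unique ((es , w , len) , bound) ((es′ , w′ , len′) , bound′) =
    ℕ.≤-antisym (subst (ℕ._≤ _) len (bound′ es w)) (subst (ℕ._≤ _) len′ (bound es′ w′))

  HasPredecessorsIn : (Fin n → Set) → Set
  HasPredecessorsIn B = ∀ u → B u → ∃[ e ] (tgt e ≡ u × B (src e))

  onWalk : Fin n → List (Fin m) → Fin n → Bool
  onWalk u es y = (y == u) ∨ any (λ e → y == tgt e) es

  walk-prefix : ∀ {u es v y} → Walk u es v → onWalk u es y ≡ true → ∃[ es′ ] Walk u es′ y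
  walk-prefix {v = v} {y} nil on with ==⇒≡ {a = y} {v} (trans (sym (∨-identityʳ _)) on)
  ... | refl = [] , nil
  walk-prefix {y = y} (cons {e = e} w) on with y Fin.≟ src e
  ... | yes refl = [] , nil
  ... | no _ with walk-prefix w on
  ... | es′ , w′ = e ∷ es′ , cons w′

  module Acyclic (isP : IsPERT) where
    open IsPERT isP

    longestPath-source : ∀ x → LongestPath x s 0
    longestPath-source x = ([] , nil , refl) , bound
      where
      bound : ∀ es → Walk s es s → pathLength x es ℕ.≤ 0
      bound [] _ = ℕ.z≤n
      bound (e ∷ es) w = ⊥-elim (acyclic s e es w)

    longestPath-step : ∀ x {v} D →
      (∃[ e ] (tgt e ≡ v × ∃[ d ] (LongestPath x (src e) d × D ≡ d ℕ.+ bit (x e)))) →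
      (∀ e → tgt e ≡ v → ∃[ d ] (LongestPath x (src e) d × d ℕ.+ bit (x e) ℕ.≤ D)) →
      LongestPath x v D
    longestPath-step x D (e , refl , d , ((es , w , len) , _) , D≡) maximal = (es ∷ʳ e , walk-∷ʳ w , attained) , bound
      where
      attained : pathLength x (es ∷ʳ e) ≡ D
      attained = trans (pathLength-∷ʳ x es e) (trans (cong (ℕ._+ bit (x e)) len) (sym D≡))
      bound : ∀ es → Walk s es (tgt e) → pathLength x es ℕ.≤ D
      bound [] w = ⊥-elim (s-source e (sym (walk-[] w)))
      bound (e₁ ∷ es₁) w with walk-last w
      ... | es′ , e′ , es≡ , w′ , tgt≡ with maximal e′ tgt≡
      ... | d′ , (_ , bound′) , d′+x≤D = begin
        pathLength x (e₁ ∷ es₁)         ≡⟨ cong (pathLength x) es≡ ⟩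
        pathLength x (es′ ∷ʳ e′)        ≡⟨ pathLength-∷ʳ x es′ e′ ⟩
        pathLength x es′ ℕ.+ bit (x e′) ≤⟨ ℕ.+-monoˡ-≤ (bit (x e′)) (bound′ es′ w′) ⟩
        d′ ℕ.+ bit (x e′)               ≤⟨ d′+x≤D ⟩
        D                               ∎
        where open ℕ.≤-Reasoning

    -- Walk backwards from v: each step either closes a cycle or puts a new vertex on the walk.
    hasPredecessorsIn⇒empty : ∀ {B} → HasPredecessorsIn B → ∀ v → ¬ B v
    hasPredecessorsIn⇒empty {B} pred v Bv = extend n v [] (countᵇ-allFin≤ _) nil Bv
      where
      offWalk : Fin n → List (Fin m) → ℕ
      offWalk u es = countᵇ (not ∘ onWalk u es) (allFin n)
      extend : ∀ fuel u es {v} → offWalk u es ℕ.≤ fuel → Walk u es v → B u → ⊥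
      extend fuel u es w≤ w Bu with pred u Bu
      ... | e , refl , Bsrc with onWalk (tgt e) es (src e) in on
      ... | true with walk-prefix w on
      ...   | es′ , w′ = acyclic (src e) e es′ (cons w′)
      extend fuel _ es w≤ w Bu | e , refl , Bsrc | false = shrink fuel w≤
        where
        fewer : offWalk (src e) (e ∷ es) ℕ.< offWalk (tgt e) es
        fewer = countᵇ-mono-< _ _ (allFin n) (λ y → not-antimono λ on′ → trans (cong ((y == src e) ∨_) on′) (∨-zeroʳ _))
                  (∈-allFin (src e)) (cong not on) (cong (λ b → not (b ∨ onWalk (tgt e) es (src e))) (==-refl (src e)))
        shrink : ∀ fuel → offWalk (tgt e) es ℕ.≤ fuel → ⊥
        shrink ℕ.zero w≤′ with () ← ℕ.≤-trans fewer w≤′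
        shrink (ℕ.suc fuel′) w≤′ = extend fuel′ (src e) (e ∷ es) (ℕ.≤-pred (ℕ.≤-trans fewer w≤′)) (cons w) Bsrc

module Firing (W : TPWN) where
  open TPWN W using (T; places; pre) renaming (trans to transitions)
  open Semantics W

  mark-∷ʳ : ∀ σ t → mark (σ ∷ʳ t) ≡ fire (mark σ) t
  mark-∷ʳ σ t = foldl-∷ʳ fire 𝐢 t σ

  μ-∷ʳ : ∀ σ t → μ (σ ∷ʳ t) ≡ upd (μ σ) t
  μ-∷ʳ σ t = foldl-∷ʳ upd μ₀ t σ

  max⊥-nothing : ∀ ys {y} → foldr max⊥ nothing ys ≡ nothing → y ∈ ys → y ≡ nothing
  max⊥-nothing (nothing ∷ ys) eq (here refl) = refl
  max⊥-nothing (nothing ∷ ys) eq (there y∈) = max⊥-nothing ys eq y∈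
  max⊥-nothing (just a ∷ ys) eq y∈ with foldr max⊥ nothing ys
  max⊥-nothing (just a ∷ ys) () y∈ | nothing
  max⊥-nothing (just a ∷ ys) () y∈ | just _

  max⊥-just : ∀ ys {D} → foldr max⊥ nothing ys ≡ just D → just D ∈ ys × (∀ d → just d ∈ ys → d ℕ.≤ D)
  max⊥-just (nothing ∷ ys) eq with max⊥-just ys eq
  ... | D∈ , upper = there D∈ , λ { d (here ()) ; d (there d∈) → upper d d∈ }
  max⊥-just (just a ∷ ys) eq with foldr max⊥ nothing ys in max-ys
  max⊥-just (just a ∷ ys) refl | nothing = here refl , upper
    where
    upper : ∀ d → just d ∈ just a ∷ ys → d ℕ.≤ a
    upper d (here refl) = ℕ.≤-refl
    upper d (there d∈) with () ← max⊥-nothing ys max-ys d∈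
  max⊥-just (just a ∷ ys) refl | just b with max⊥-just ys max-ys
  ... | b∈ , upper = member (ℕ.⊔-sel a b) ,
        λ { d (here refl) → ℕ.m≤m⊔n a b ; d (there d∈) → ℕ.≤-trans (upper d d∈) (ℕ.m≤n⊔m a b) }
    where
    member : (a ℕ.⊔ b ≡ a) ⊎ (a ℕ.⊔ b ≡ b) → just (a ℕ.⊔ b) ∈ just a ∷ ys
    member (inj₁ eq) rewrite eq = here refl
    member (inj₂ eq) rewrite eq = there b∈

  module _ (Sch : Scheduler) where

    expectStep : List T → (List T → ℚ) → ℚ
    expectStep h g = sumℚ transitions (λ t → stepProb Sch h t * g (h ∷ʳ t))

    probFrom-∷ʳ : ∀ hist σ t → probFrom Sch hist (σ ∷ʳ t) ≡ probFrom Sch hist σ * stepProb Sch (hist ++ σ) t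
    probFrom-∷ʳ hist [] t = begin
      stepProb Sch hist t * 1ℚ        ≡⟨ ℚ.*-comm (stepProb Sch hist t) 1ℚ ⟩
      1ℚ * stepProb Sch hist t        ≡⟨ cong (λ h → 1ℚ * stepProb Sch h t) (sym (++-identityʳ hist)) ⟩
      1ℚ * stepProb Sch (hist ++ []) t ∎
      where open ≡-Reasoning
    probFrom-∷ʳ hist (t₀ ∷ σ) t = begin
      stepProb Sch hist t₀ * probFrom Sch (hist ∷ʳ t₀) (σ ∷ʳ t)
        ≡⟨ cong (stepProb Sch hist t₀ *_) (probFrom-∷ʳ (hist ∷ʳ t₀) σ t) ⟩
      stepProb Sch hist t₀ * (probFrom Sch (hist ∷ʳ t₀) σ * stepProb Sch ((hist ∷ʳ t₀) ++ σ) t)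
        ≡⟨ sym (ℚ.*-assoc (stepProb Sch hist t₀) (probFrom Sch (hist ∷ʳ t₀) σ) (stepProb Sch ((hist ∷ʳ t₀) ++ σ) t)) ⟩
      stepProb Sch hist t₀ * probFrom Sch (hist ∷ʳ t₀) σ * stepProb Sch ((hist ∷ʳ t₀) ++ σ) t
        ≡⟨ cong (λ h → stepProb Sch hist t₀ * probFrom Sch (hist ∷ʳ t₀) σ * stepProb Sch h t) (++-assoc hist [ t₀ ] σ) ⟩
      stepProb Sch hist t₀ * probFrom Sch (hist ∷ʳ t₀) σ * stepProb Sch (hist ++ t₀ ∷ σ) t
        ∎
      where open ≡-Reasoning

    seqs-step : ∀ j g →
      sumℚ (seqs Sch (ℕ.suc j)) (λ σ → prob Sch σ * g σ) ≡ sumℚ (seqs Sch j) (λ σ → prob Sch σ * expectStep σ g)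
    seqs-step j g = trans (sumℚ-concatMap _ (seqs Sch j) (λ σ → prob Sch σ * g σ)) (sumℚ-cong (seqs Sch j) λ σ → begin
      sumℚ (map (σ ∷ʳ_) transitions) (λ σ′ → prob Sch σ′ * g σ′)
        ≡⟨ sumℚ-map (σ ∷ʳ_) transitions (λ σ′ → prob Sch σ′ * g σ′) ⟩
      sumℚ transitions (λ t → prob Sch (σ ∷ʳ t) * g (σ ∷ʳ t))
        ≡⟨ sumℚ-cong transitions (λ t → trans (cong (_* g (σ ∷ʳ t)) (probFrom-∷ʳ [] σ t)) (ℚ.*-assoc (prob Sch σ) _ _)) ⟩
      sumℚ transitions (λ t → prob Sch σ * (stepProb Sch σ t * g (σ ∷ʳ t)))
        ≡⟨ sumℚ-*ˡ transitions (prob Sch σ) (λ t → stepProb Sch σ t * g (σ ∷ʳ t)) ⟩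
      prob Sch σ * expectStep σ g
        ∎)
      where open ≡-Reasoning

  module Complete (places-complete : ∀ q → q ∈ places) (transitions-complete : ∀ t → t ∈ transitions) where

    enabled-sound : ∀ {t M q} → enabled t M ≡ true → pre q t ≡ true → 1 ℕ.≤ M q
    enabled-sound {t} {M} {q} en pq with all-sound (λ q → not (pre q t) ∨ ⌊ 1 ℕ.≤? M q ⌋) places en (places-complete q)
    ... | ok rewrite pq = toWitness (from T-≡ ok)

    enabled-complete : ∀ {t M} → (∀ q → pre q t ≡ true → 1 ℕ.≤ M q) → enabled t M ≡ true
    enabled-complete {t} {M} marked = all-complete _ places input-marked
      where
      input-marked : ∀ q → not (pre q t) ∨ ⌊ 1 ℕ.≤? M q ⌋ ≡ true
      input-marked q with pre q t in pq
      ... | false = refl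
      ... | true = to T-≡ (fromWitness (marked q pq))

    disabled-sound : ∀ {t M} → enabled t M ≡ false → ∃[ q ] (pre q t ≡ true × M q ≡ 0)
    disabled-sound {t} {M} dis with all-false (λ q → not (pre q t) ∨ ⌊ 1 ℕ.≤? M q ⌋) places dis
    ... | q , ok with pre q t in pq | M q in Mq
    ... | true | ℕ.zero = q , pq , Mq
    ... | true | ℕ.suc _ with () ← ok
    ... | false | _ with () ← ok

    someEnabled-sound : ∀ {M} → someEnabled M ≡ true → ∃[ t ] (enabled t M ≡ true)
    someEnabled-sound {M} se with any-sound (λ t → enabled t M) transitions se
    ... | t , _ , en = t , en

    noneEnabled-sound : ∀ {M} → someEnabled M ≡ false → ∀ t → enabled t M ≡ false
    noneEnabled-sound {M} dead t = any-false-sound (λ t → enabled t M) transitions dead (transitions-complete t)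

    isMarking-sound : ∀ {M M′} → isMarking M M′ ≡ true → ∀ q → M q ≡ M′ q
    isMarking-sound {M} {M′} eq q = toWitness (from T-≡ (all-sound (λ q → ⌊ M q ℕ.≟ M′ q ⌋) places eq (places-complete q)))

    isMarking-complete : ∀ {M M′} → (∀ q → M q ≡ M′ q) → isMarking M M′ ≡ true
    isMarking-complete {M} {M′} M≗M′ = all-complete _ places λ q → to T-≡ (fromWitness (M≗M′ q))

module Net (𝒫 : PERT) (isP : PERTDefs.IsPERT 𝒫) where
  open PERT 𝒫
  open PERTDefs 𝒫
  open IsPERT isP
  open Semantics W𝒫
  open Paths 𝒫
  open Acyclic isP
  open Firing W𝒫

  placesW : List PlaceW
  placesW = TPWN.places W𝒫

  transitionsW : List TransW
  transitionsW = TPWN.trans W𝒫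

  places-complete : ∀ q → q ∈ placesW
  places-complete pI = here refl
  places-complete pO = there (here refl)
  places-complete (pIn e) = there (there (∈-++⁺ˡ (∈-map⁺ pIn (∈-allFin e))))
  places-complete (pOut e) = there (there (∈-++⁺ʳ (map pIn (allFin m)) (∈-map⁺ pOut (∈-allFin e))))

  transitions-complete : ∀ t → t ∈ transitionsW
  transitions-complete (tE e false) = ∈-++⁺ˡ (∈-map⁺ (λ e → tE e false) (∈-allFin e))
  transitions-complete (tE e true) =
    ∈-++⁺ʳ (map (λ e → tE e false) (allFin m)) (∈-++⁺ˡ (∈-map⁺ (λ e → tE e true) (∈-allFin e)))
  transitions-complete (tV v) =
    ∈-++⁺ʳ (map (λ e → tE e false) (allFin m)) (∈-++⁺ʳ (map (λ e → tE e true) (allFin m)) (∈-map⁺ tV (∈-allFin v)))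

  open Complete places-complete transitions-complete

  isVertex : Fin n → TransW → Bool
  isVertex u (tV v) = u == v
  isVertex u (tE _ _) = false

  isEdge : Fin m → TransW → Bool
  isEdge e (tE e′ _) = e == e′
  isEdge e (tV _) = false

  vertexFired : List TransW → Fin n → Bool
  vertexFired h u = any (isVertex u) h

  edgeFired : List TransW → Fin m → Bool
  edgeFired h e = any (isEdge e) h

  marked : List TransW → PlaceW → Bool
  marked h pI = not (vertexFired h s)
  marked h pO = vertexFired h t
  marked h (pIn e) = vertexFired h (src e) ∧ not (edgeFired h e)
  marked h (pOut e) = edgeFired h e ∧ not (vertexFired h (tgt e))

  vertexFired-∷ʳ : ∀ h t′ u → vertexFired (h ∷ʳ t′) u ≡ vertexFired h u ∨ isVertex u t′
  vertexFired-∷ʳ h t′ u = any-∷ʳ (isVertex u) h t′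

  edgeFired-∷ʳ : ∀ h t′ e → edgeFired (h ∷ʳ t′) e ≡ edgeFired h e ∨ isEdge e t′
  edgeFired-∷ʳ h t′ e = any-∷ʳ (isEdge e) h t′

  vertexFired-∷ʳ-tE : ∀ h e b u → vertexFired (h ∷ʳ tE e b) u ≡ vertexFired h u
  vertexFired-∷ʳ-tE h e b u = trans (vertexFired-∷ʳ h (tE e b) u) (∨-identityʳ _)

  edgeFired-∷ʳ-tV : ∀ h v e → edgeFired (h ∷ʳ tV v) e ≡ edgeFired h e
  edgeFired-∷ʳ-tV h v e = trans (edgeFired-∷ʳ h (tV v) e) (∨-identityʳ _)

  1≤bit : ∀ {b} → 1 ℕ.≤ bit b → b ≡ true
  1≤bit {true} _ = refl

  bit≡0 : ∀ {b} → bit b ≡ 0 → b ≡ false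
  bit≡0 {false} _ = refl

  record FiringInvariant (h : List TransW) : Set where
    field
      mark≡marked : ∀ q → mark h q ≡ bit (marked h q)
      edge⇒source : ∀ e → edgeFired h e ≡ true → vertexFired h (src e) ≡ true
      target⇒edge : ∀ e → vertexFired h (tgt e) ≡ true → edgeFired h e ≡ true
  open FiringInvariant public

  firing-[] : FiringInvariant []
  firing-[] = record
    { mark≡marked = λ { pI → refl ; pO → refl ; (pIn e) → refl ; (pOut e) → refl }
    ; edge⇒source = λ _ ()
    ; target⇒edge = λ _ ()
    }

  module _ {h : List TransW} (I : FiringInvariant h) where

    enabled⇒marked : ∀ t′ → enabled t′ (mark h) ≡ true → ∀ q → preW q t′ ≡ true → marked h q ≡ true
    enabled⇒marked t′ en q pq = 1≤bit (subst (1 ℕ.≤_) (mark≡marked I q) (enabled-sound {q = q} en pq))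

    marked⇒enabled : ∀ t′ → (∀ q → preW q t′ ≡ true → marked h q ≡ true) → enabled t′ (mark h) ≡ true
    marked⇒enabled t′ inputs-marked = enabled-complete λ q pq →
      subst (1 ℕ.≤_) (sym (trans (mark≡marked I q) (cong bit (inputs-marked q pq)))) ℕ.≤-refl

    disabled⇒unmarked : ∀ t′ → enabled t′ (mark h) ≡ false → ∃[ q ] (preW q t′ ≡ true × marked h q ≡ false)
    disabled⇒unmarked t′ dis with disabled-sound dis
    ... | q , pq , Mq≡0 = q , pq , bit≡0 (trans (sym (mark≡marked I q)) Mq≡0)

    edge-enabled : ∀ {e b} → enabled (tE e b) (mark h) ≡ true → vertexFired h (src e) ≡ true × edgeFired h e ≡ false
    edge-enabled {e} {b} en with vertexFired h (src e) | edgeFired h e | enabled⇒marked (tE e b) en (pIn e) (==-refl e)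
    ... | true | false | _ = refl , refl

    vertex-enabled : ∀ {v} → enabled (tV v) (mark h) ≡ true → vertexFired h v ≡ false
    vertex-enabled {v} en = unfired (v Fin.≟ s)
      where
      unfired : Dec (v ≡ s) → vertexFired h v ≡ false
      unfired (yes refl) with vertexFired h s | enabled⇒marked (tV s) en pI (==-refl s)
      ... | false | _ = refl
      unfired (no v≢s) with s-unique v v≢s
      ... | e , refl with vertexFired h (tgt e) | enabled⇒marked (tV (tgt e)) en (pOut e) (==-refl (tgt e))
      ...   | false | _ = refl
      ...   | true | e-marked with () ← trans (sym e-marked) (∧-zeroʳ (edgeFired h e))

    vertex-enabled⇒inputs-fired : ∀ {e} → enabled (tV (tgt e)) (mark h) ≡ true → edgeFired h e ≡ true
    vertex-enabled⇒inputs-fired {e} en with edgeFired h e | enabled⇒marked (tV (tgt e)) en (pOut e) (==-refl (tgt e))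
    ... | true | _ = refl

    post⇒unmarked : ∀ t′ → enabled t′ (mark h) ≡ true → ∀ q → postW t′ q ≡ true → marked h q ≡ false
    post⇒unmarked (tE e b) en (pOut e′) post with ==⇒≡ {a = e} {e′} post
    ... | refl rewrite proj₂ (edge-enabled en) = refl
    post⇒unmarked (tV v) en (pIn e′) post with ==⇒≡ {a = src e′} {v} post
    ... | refl rewrite vertex-enabled en = refl
    post⇒unmarked (tV v) en pO post with ==⇒≡ {a = v} {t} post
    ... | refl = vertex-enabled en

    marked-∷ʳ : ∀ t′ → enabled t′ (mark h) ≡ true →
      ∀ q → marked (h ∷ʳ t′) q ≡ (marked h q ∧ not (preW q t′)) ∨ postW t′ q
    marked-∷ʳ (tE e b) en pI rewrite vertexFired-∷ʳ-tE h e b s = ∧-true-∨-false _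
    marked-∷ʳ (tE e b) en pO rewrite vertexFired-∷ʳ-tE h e b t = ∧-true-∨-false _
    marked-∷ʳ (tE e b) en (pIn e′) rewrite vertexFired-∷ʳ-tE h e b (src e′) | edgeFired-∷ʳ h (tE e b) e′ =
      ∧-not-∨ (vertexFired h (src e′)) (edgeFired h e′) (e′ == e)
    marked-∷ʳ (tE e b) en (pOut e′) rewrite vertexFired-∷ʳ-tE h e b (tgt e′) | edgeFired-∷ʳ h (tE e b) e′ with e Fin.≟ e′
    ... | yes refl rewrite ==-refl e | proj₂ (edge-enabled en) | contraposeᵇ (target⇒edge I e) (proj₂ (edge-enabled en)) = refl
    ... | no e≢e′ rewrite ≢⇒==-false (e≢e′ ∘ sym) = ∨-false-∧ (edgeFired h e′) _
    marked-∷ʳ (tV v) en pI rewrite vertexFired-∷ʳ h (tV v) s | ==-sym s v = ∧-not-∨ true (vertexFired h s) (v == s)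
    marked-∷ʳ (tV v) en pO rewrite vertexFired-∷ʳ h (tV v) t | ==-sym t v = ∨-∧-true (vertexFired h t) (v == t)
    marked-∷ʳ (tV v) en (pIn e′) rewrite vertexFired-∷ʳ h (tV v) (src e′) | edgeFired-∷ʳ-tV h v e′ with src e′ Fin.≟ v
    ... | yes refl rewrite vertex-enabled en | contraposeᵇ (edge⇒source I e′) (vertex-enabled en) = refl
    ... | no _ = ∨-false-∧ (vertexFired h (src e′)) _
    marked-∷ʳ (tV v) en (pOut e′) rewrite vertexFired-∷ʳ h (tV v) (tgt e′) | edgeFired-∷ʳ-tV h v e′ =
      ∧-not-∨ (edgeFired h e′) (vertexFired h (tgt e′)) (tgt e′ == v)

  pre⇒¬post : ∀ q t′ → preW q t′ ≡ true → postW t′ q ≡ false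
  pre⇒¬post pI (tV v) _ = refl
  pre⇒¬post (pIn e′) (tE e b) _ = refl
  pre⇒¬post (pOut e′) (tV v) _ = refl

  -- The firing rule on 1-safe places: t is enabled, t• is unmarked and •t ∩ t• = ∅.
  bit-fire : ∀ a b c → (b ≡ true → a ≡ true) → (c ≡ true → a ≡ false) → (b ≡ true → c ≡ false) →
    (bit a ℕ.∸ bit b) ℕ.+ bit c ≡ bit ((a ∧ not b) ∨ c)
  bit-fire true true true _ _ b⇒¬c with () ← b⇒¬c refl
  bit-fire true true false _ _ _ = refl
  bit-fire true false true _ c⇒¬a _ with () ← c⇒¬a refl
  bit-fire true false false _ _ _ = refl
  bit-fire false true c b⇒a _ _ with () ← b⇒a refl
  bit-fire false false true _ _ _ = refl
  bit-fire false false false _ _ _ = refl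

  firing-∷ʳ : ∀ {h} → FiringInvariant h → ∀ t′ → enabled t′ (mark h) ≡ true → FiringInvariant (h ∷ʳ t′)
  firing-∷ʳ {h} I t′ en = record
    { mark≡marked = mark≡marked′
    ; edge⇒source = edge⇒source′ t′ en
    ; target⇒edge = target⇒edge′ t′ en
    }
    where
    mark≡marked′ : ∀ q → mark (h ∷ʳ t′) q ≡ bit (marked (h ∷ʳ t′) q)
    mark≡marked′ q = begin
      mark (h ∷ʳ t′) q
        ≡⟨ cong (λ M → M q) (mark-∷ʳ h t′) ⟩
      (mark h q ℕ.∸ bit (preW q t′)) ℕ.+ bit (postW t′ q)
        ≡⟨ cong (λ k → (k ℕ.∸ bit (preW q t′)) ℕ.+ bit (postW t′ q)) (mark≡marked I q) ⟩
      (bit (marked h q) ℕ.∸ bit (preW q t′)) ℕ.+ bit (postW t′ q)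
        ≡⟨ bit-fire _ _ _ (enabled⇒marked I t′ en q) (post⇒unmarked I t′ en q) (pre⇒¬post q t′) ⟩
      bit ((marked h q ∧ not (preW q t′)) ∨ postW t′ q)
        ≡⟨ cong bit (sym (marked-∷ʳ I t′ en q)) ⟩
      bit (marked (h ∷ʳ t′) q)
        ∎
      where open ≡-Reasoning
    edge⇒source′ : ∀ t′ → enabled t′ (mark h) ≡ true →
      ∀ e → edgeFired (h ∷ʳ t′) e ≡ true → vertexFired (h ∷ʳ t′) (src e) ≡ true
    edge⇒source′ (tE e₀ b) en e fired rewrite edgeFired-∷ʳ h (tE e₀ b) e | vertexFired-∷ʳ-tE h e₀ b (src e) with edgeFired h e in old
    ... | true = edge⇒source I e old
    ... | false with ==⇒≡ {a = e} {e₀} fired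
    ...   | refl = proj₁ (edge-enabled I en)
    edge⇒source′ (tV v) en e fired rewrite edgeFired-∷ʳ-tV h v e | vertexFired-∷ʳ h (tV v) (src e) | edge⇒source I e fired = refl
    target⇒edge′ : ∀ t′ → enabled t′ (mark h) ≡ true →
      ∀ e → vertexFired (h ∷ʳ t′) (tgt e) ≡ true → edgeFired (h ∷ʳ t′) e ≡ true
    target⇒edge′ (tE e₀ b) en e fired
      rewrite edgeFired-∷ʳ h (tE e₀ b) e | vertexFired-∷ʳ-tE h e₀ b (tgt e) | target⇒edge I e fired = refl
    target⇒edge′ (tV v) en e fired rewrite edgeFired-∷ʳ-tV h v e | vertexFired-∷ʳ h (tV v) (tgt e) with vertexFired h (tgt e) in old
    ... | true = target⇒edge I e old
    ... | false with ==⇒≡ {a = tgt e} {v} fired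
    ...   | refl = vertex-enabled⇒inputs-fired I en

  unfired : List TransW → ℕ
  unfired h = countᵇ (not ∘ vertexFired h) (allFin n) ℕ.+ countᵇ (not ∘ edgeFired h) (allFin m)

  unfired≤ : ∀ h → unfired h ℕ.≤ n ℕ.+ m
  unfired≤ h = ℕ.+-mono-≤ (countᵇ-allFin≤ (not ∘ vertexFired h)) (countᵇ-allFin≤ (not ∘ edgeFired h))

  unfired-∷ʳ : ∀ {h} → FiringInvariant h → ∀ t′ → enabled t′ (mark h) ≡ true → unfired (h ∷ʳ t′) ℕ.< unfired h
  unfired-∷ʳ {h} I (tE e b) en = ℕ.+-mono-≤-<
    (countᵇ-mono _ _ (allFin n) λ u → not-antimono (any-∷ʳ⁺ (isVertex u) h (tE e b)))
    (countᵇ-mono-< _ _ (allFin m) (λ e′ → not-antimono (any-∷ʳ⁺ (isEdge e′) h (tE e b))) (∈-allFin e)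
      (cong not (proj₂ (edge-enabled I en)))
      (cong not (trans (edgeFired-∷ʳ h (tE e b) e) (trans (cong (edgeFired h e ∨_) (==-refl e)) (∨-zeroʳ _)))))
  unfired-∷ʳ {h} I (tV v) en = ℕ.+-mono-<-≤
    (countᵇ-mono-< _ _ (allFin n) (λ u → not-antimono (any-∷ʳ⁺ (isVertex u) h (tV v))) (∈-allFin v)
      (cong not (vertex-enabled I en))
      (cong not (trans (vertexFired-∷ʳ h (tV v) v) (trans (cong (vertexFired h v ∨_) (==-refl v)) (∨-zeroʳ _)))))
    (countᵇ-mono _ _ (allFin m) λ e′ → not-antimono (any-∷ʳ⁺ (isEdge e′) h (tV v)))

  input-place : ∀ t′ → ∃[ q ] (preW q t′ ≡ true × q ≢ pO)
  input-place (tE e b) = pIn e , ==-refl e , λ ()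
  input-place (tV v) = from-dec (v Fin.≟ s)
    where
    from-dec : Dec (v ≡ s) → ∃[ q ] (preW q (tV v) ≡ true × q ≢ pO)
    from-dec (yes refl) = pI , ==-refl s , λ ()
    from-dec (no v≢s) with s-unique v v≢s
    ... | e , refl = pOut e , ==-refl (tgt e) , λ ()

  𝐨⇒dead : ∀ h → isMarking (mark h) 𝐨 ≡ true → ∀ t′ → enabled t′ (mark h) ≡ false
  𝐨⇒dead h at-𝐨 t′ with enabled t′ (mark h) in en | input-place t′
  ... | false | _ = refl
  ... | true | q , pq , q≢pO =
    ⊥-elim (1≰𝐨 q q≢pO (subst (1 ℕ.≤_) (isMarking-sound {mark h} {𝐨} at-𝐨 q) (enabled-sound {t = t′} {q = q} en pq)))
    where
    1≰𝐨 : ∀ q → q ≢ pO → ¬ (1 ℕ.≤ 𝐨 q)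
    1≰𝐨 pO q≢pO _ = q≢pO refl

  live⇒¬𝐨 : ∀ h → someEnabled (mark h) ≡ true → isMarking (mark h) 𝐨 ≡ false
  live⇒¬𝐨 h live with isMarking (mark h) 𝐨 in at-𝐨 | someEnabled-sound live
  ... | false | _ = refl
  ... | true | t′ , en with () ← trans (sym en) (𝐨⇒dead h at-𝐨 t′)

  module _ {h : List TransW} (I : FiringInvariant h) where

    dead⇒vertices-fired : someEnabled (mark h) ≡ false → ∀ v → vertexFired h v ≡ true
    dead⇒vertices-fired dead v with vertexFired h v in v-fired
    ... | true = refl
    ... | false = ⊥-elim (hasPredecessorsIn⇒empty predecessor v v-fired)
      where
      predecessor : HasPredecessorsIn (λ u → vertexFired h u ≡ false)
      predecessor u u-unfired with disabled⇒unmarked I (tV u) (noneEnabled-sound dead (tV u))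
      ... | pI , pq , unmarked with ==⇒≡ {a = u} {s} pq
      ...   | refl with () ← trans (sym unmarked) (cong not u-unfired)
      predecessor u u-unfired | pO , () , _
      predecessor u u-unfired | pIn _ , () , _
      predecessor u u-unfired | pOut e , pq , unmarked with ==⇒≡ {a = tgt e} {u} pq
      ... | refl = e , refl , source-unfired
        where
        edge-unfired : edgeFired h e ≡ false
        edge-unfired = trans (sym (∧-identityʳ _)) (trans (cong (λ b → edgeFired h e ∧ not b) (sym u-unfired)) unmarked)
        source-unfired : vertexFired h (src e) ≡ false
        source-unfired with disabled⇒unmarked I (tE e false) (noneEnabled-sound dead (tE e false))
        ... | pI , () , _
        ... | pO , () , _
        ... | pOut _ , () , _
        ... | pIn e′ , pq′ , unmarked′ with ==⇒≡ {a = e′} {e} pq′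
        ...   | refl = trans (sym (∧-identityʳ _)) (trans (cong (λ b → vertexFired h (src e) ∧ not b) (sym edge-unfired)) unmarked′)

    dead⇒marked≡𝐨 : someEnabled (mark h) ≡ false → ∀ q → bit (marked h q) ≡ 𝐨 q
    dead⇒marked≡𝐨 dead pI rewrite dead⇒vertices-fired dead s = refl
    dead⇒marked≡𝐨 dead pO rewrite dead⇒vertices-fired dead t = refl
    dead⇒marked≡𝐨 dead (pIn e)
      rewrite target⇒edge I e (dead⇒vertices-fired dead (tgt e)) | ∧-zeroʳ (vertexFired h (src e)) = refl
    dead⇒marked≡𝐨 dead (pOut e) rewrite dead⇒vertices-fired dead (tgt e) | ∧-zeroʳ (edgeFired h e) = refl

    dead⇒𝐨 : someEnabled (mark h) ≡ false → isMarking (mark h) 𝐨 ≡ true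
    dead⇒𝐨 dead = isMarking-complete λ q → trans (mark≡marked I q) (dead⇒marked≡𝐨 dead q)

module Timing (𝒫 : PERT) (isP : PERTDefs.IsPERT 𝒫) where
  open PERT 𝒫
  open PERTDefs 𝒫
  open Semantics W𝒫
  open Paths 𝒫
  open Acyclic isP
  open Firing W𝒫
  open Net 𝒫 isP

  TokenTime : Outcome → PlaceW → ℕ → Set
  TokenTime x pI d = d ≡ 0
  TokenTime x pO d = LongestPath x t d
  TokenTime x (pIn e) d = LongestPath x (src e) d
  TokenTime x (pOut e) d = ∃[ d′ ] (LongestPath x (src e) d′ × d ≡ d′ ℕ.+ bit (x e))

  record TimingInvariant (x : Outcome) (h : List TransW) : Set where
    field
      μ-unmarked : ∀ q → marked h q ≡ false → μ h q ≡ nothing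
      μ-marked : ∀ q → marked h q ≡ true → ∃[ d ] (μ h q ≡ just d × TokenTime x q d)
  open TimingInvariant public

  timing-[] : ∀ x → TimingInvariant x []
  timing-[] x = record
    { μ-unmarked = λ { pI () ; pO _ → refl ; (pIn e) _ → refl ; (pOut e) _ → refl }
    ; μ-marked = λ { pI _ → 0 , refl , refl ; pO () ; (pIn e) () ; (pOut e) () }
    }

  inputTimes : List TransW → TransW → List (Maybe ℕ)
  inputTimes h t′ = map (μ h) (boolFilter (λ q → preW q t′) placesW)

  inputTime : List TransW → TransW → Maybe ℕ
  inputTime h t′ = foldr max⊥ nothing (inputTimes h t′)

  input∈ : ∀ h {t′} q → preW q t′ ≡ true → μ h q ∈ inputTimes h t′
  input∈ h {t′} q pq = ∈-map-boolFilter⁺ (μ h) (λ q → preW q t′) placesW (places-complete q) pq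

  module _ {x : Outcome} {h : List TransW} (I : FiringInvariant h) (J : TimingInvariant x h) where

    inputTime-max : ∀ t′ → enabled t′ (mark h) ≡ true →
      ∃[ D ] (inputTime h t′ ≡ just D × (∀ q d → preW q t′ ≡ true → μ h q ≡ just d → d ℕ.≤ D)
                                      × ∃[ q ] (preW q t′ ≡ true × TokenTime x q D))
    inputTime-max t′ en with inputTime h t′ in max≡ | input-place t′
    ... | nothing | q , pq , _ with μ-marked J q (enabled⇒marked I t′ en q pq)
    ...   | d , μq , _ with () ← trans (sym μq) (max⊥-nothing (inputTimes h t′) max≡ (input∈ h q pq))
    inputTime-max t′ en | just D | _ with max⊥-just (inputTimes h t′) max≡
    ... | D∈ , upper with ∈-map-boolFilter⁻ (μ h) (λ q → preW q t′) placesW D∈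
    ...   | q , pq , μq with μ-marked J q (enabled⇒marked I t′ en q pq)
    ...     | d , μq′ , time with trans μq μq′
    ...       | refl = D , refl , bounded , q , pq , time
      where
      bounded : ∀ q′ d′ → preW q′ t′ ≡ true → μ h q′ ≡ just d′ → d′ ℕ.≤ D
      bounded q′ d′ pq′ μq′ = upper d′ (subst (_∈ inputTimes h t′) μq′ (input∈ h q′ pq′))

    inputTime-tE : ∀ {e b} → enabled (tE e b) (mark h) ≡ true → ∃[ D ] (inputTime h (tE e b) ≡ just D × LongestPath x (src e) D)
    inputTime-tE {e} {b} en with inputTime-max (tE e b) en
    ... | D , max≡ , _ , pIn e′ , pq , time with ==⇒≡ {a = e′} {e} pq
    ...   | refl = D , max≡ , time

    inputTime-tV : ∀ {v} → enabled (tV v) (mark h) ≡ true → ∃[ D ] (inputTime h (tV v) ≡ just D × LongestPath x v D)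
    inputTime-tV {v} en with inputTime-max (tV v) en
    ... | D , max≡ , _ , pI , pq , refl with ==⇒≡ {a = v} {s} pq
    ...   | refl = 0 , max≡ , longestPath-source x
    inputTime-tV {v} en | D , max≡ , bounded , pOut e , pq , attained with ==⇒≡ {a = tgt e} {v} pq
    ... | refl = D , max≡ , longestPath-step x D (e , refl , attained) maximal
      where
      maximal : ∀ e′ → tgt e′ ≡ tgt e → ∃[ d ] (LongestPath x (src e′) d × d ℕ.+ bit (x e′) ℕ.≤ D)
      maximal e′ tgt≡ = from-token (μ-marked J (pOut e′) (enabled⇒marked I (tV (tgt e)) en (pOut e′) is-input))
        where
        is-input : preW (pOut e′) (tV (tgt e)) ≡ true
        is-input = trans (cong (_== tgt e) tgt≡) (==-refl (tgt e))
        from-token : ∃[ d ] (μ h (pOut e′) ≡ just d × TokenTime x (pOut e′) d) →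
                     ∃[ d ] (LongestPath x (src e′) d × d ℕ.+ bit (x e′) ℕ.≤ D)
        from-token (d , μ≡ , d′ , lp , d≡) = d′ , lp , subst (ℕ._≤ D) d≡ (bounded (pOut e′) d is-input μ≡)

  FollowsOutcome : Outcome → TransW → Set
  FollowsOutcome x (tE e b) = b ≡ x e
  FollowsOutcome x (tV v) = ⊤

  τW-tE : ∀ e b → τW (tE e b) ≡ bit b
  τW-tE e true = refl
  τW-tE e false = refl

  timing-∷ʳ : ∀ {x h} → FiringInvariant h → TimingInvariant x h →
    ∀ t′ → enabled t′ (mark h) ≡ true → FollowsOutcome x t′ → TimingInvariant x (h ∷ʳ t′)
  timing-∷ʳ {x} {h} I J t′ en follows = record { μ-unmarked = unmarked′ ; μ-marked = marked′ }
    where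
    μ-step : ∀ q → μ (h ∷ʳ t′) q ≡ (if postW t′ q then inputTime h t′ +⊥ τW t′ else (if preW q t′ then nothing else μ h q))
    μ-step q = cong (λ f → f q) (μ-∷ʳ h t′)

    output-time : ∀ t′ → enabled t′ (mark h) ≡ true → FollowsOutcome x t′ →
      ∀ q → postW t′ q ≡ true → ∃[ d ] (inputTime h t′ +⊥ τW t′ ≡ just d × TokenTime x q d)
    output-time (tE e b) en refl (pOut e′) post with ==⇒≡ {a = e} {e′} post
    ... | refl with inputTime-tE I J en
    ...   | D , max≡ , lp rewrite max≡ = D ℕ.+ τW (tE e (x e)) , refl , D , lp , cong (D ℕ.+_) (τW-tE e (x e))
    output-time (tV v) en _ (pIn e′) post with ==⇒≡ {a = src e′} {v} post
    ... | refl with inputTime-tV I J en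
    ...   | D , max≡ , lp rewrite max≡ = D ℕ.+ 0 , refl , subst (LongestPath x (src e′)) (sym (ℕ.+-identityʳ D)) lp
    output-time (tV v) en _ pO post with ==⇒≡ {a = v} {t} post
    ... | refl with inputTime-tV I J en
    ...   | D , max≡ , lp rewrite max≡ = D ℕ.+ 0 , refl , subst (LongestPath x t) (sym (ℕ.+-identityʳ D)) lp

    unmarked′ : ∀ q → marked (h ∷ʳ t′) q ≡ false → μ (h ∷ʳ t′) q ≡ nothing
    unmarked′ q unmarked rewrite μ-step q | marked-∷ʳ I t′ en q with postW t′ q | preW q t′
    ... | true | pre with () ← trans (sym unmarked) (∨-zeroʳ (marked h q ∧ not pre))
    ... | false | true = refl
    ... | false | false = μ-unmarked J q (trans (∧-true-∨-false _) unmarked)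

    marked′ : ∀ q → marked (h ∷ʳ t′) q ≡ true → ∃[ d ] (μ (h ∷ʳ t′) q ≡ just d × TokenTime x q d)
    marked′ q now-marked rewrite μ-step q | marked-∷ʳ I t′ en q with postW t′ q in post | preW q t′
    ... | true | _ = output-time t′ en follows q post
    ... | false | true with () ← trans (sym now-marked) (cong (_∨ false) (∧-zeroʳ (marked h q)))
    ... | false | false = μ-marked J q (trans (∧-true-∨-false _) now-marked)

  dead⇒time : ∀ {x h} → FiringInvariant h → TimingInvariant x h → someEnabled (mark h) ≡ false →
    ∃[ D ] (time⊥ h ≡ just D × LongestPath x t D)
  dead⇒time {x} {h} I J dead with μ-marked J pO (1≤bit (ℕ.≤-reflexive (sym (dead⇒marked≡𝐨 I dead pO))))
  ... | D , μo , lp with time⊥ h in time≡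
  ... | nothing with () ← trans (sym μo) (max⊥-nothing (map (μ h) placesW) time≡ (∈-map⁺ (μ h) (places-complete pO)))
  ... | just D′ with ∈-map⁻ (μ h) (proj₁ (max⊥-just (map (μ h) placesW) time≡))
  ...   | q , _ , D′≡ = D′ , refl , subst (LongestPath x t) (sym (only-pO q D′≡)) lp
    where
    unmarked : ∀ q → 𝐨 q ≡ 0 → μ h q ≡ nothing
    unmarked q 𝐨q≡0 = μ-unmarked J q (bit≡0 (trans (dead⇒marked≡𝐨 I dead q) 𝐨q≡0))
    only-pO : ∀ q → just D′ ≡ μ h q → D′ ≡ D
    only-pO pO D′≡ with trans D′≡ μo
    ... | refl = refl
    only-pO pI D′≡ with () ← trans D′≡ (unmarked pI refl)
    only-pO (pIn e) D′≡ with () ← trans D′≡ (unmarked (pIn e) refl)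
    only-pO (pOut e) D′≡ with () ← trans D′≡ (unmarked (pOut e) refl)

module Clusters (𝒫 : PERT) (isP : PERTDefs.IsPERT 𝒫) where
  open PERT 𝒫
  open PERTDefs 𝒫
  open Semantics W𝒫
  open Paths 𝒫
  open Net 𝒫 isP

  sameCluster : TransW → TransW → Bool
  sameCluster (tV v) t′ = isVertex v t′
  sameCluster (tE e _) t′ = isEdge e t′

  same-cluster⇒same-preset : ∀ r t′ → sameCluster r t′ ≡ true → ∀ q → preW q r ≡ preW q t′
  same-cluster⇒same-preset (tV v) (tV v′) same q with ==⇒≡ {a = v} {v′} same
  ... | refl = refl
  same-cluster⇒same-preset (tE e b) (tE e′ b′) same q with ==⇒≡ {a = e} {e′} same
  ... | refl = preset-tE q
    where
    preset-tE : ∀ q → preW q (tE e b) ≡ preW q (tE e b′)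
    preset-tE pI = refl
    preset-tE pO = refl
    preset-tE (pIn _) = refl
    preset-tE (pOut _) = refl

  other-cluster⇒disjoint-presets : ∀ r t′ → sameCluster r t′ ≡ false → ∀ q → preW q r ∧ preW q t′ ≡ false
  other-cluster⇒disjoint-presets (tV v) (tV v′) other pI rewrite ==-sym v s | ==-sym v′ s = ==-∧-== s other
  other-cluster⇒disjoint-presets (tV v) (tV v′) other (pOut e) = ==-∧-== (tgt e) other
  other-cluster⇒disjoint-presets (tV v) (tV v′) other pO = refl
  other-cluster⇒disjoint-presets (tV v) (tV v′) other (pIn _) = refl
  other-cluster⇒disjoint-presets (tV v) (tE e b) other pI = ∧-zeroʳ (v == s)
  other-cluster⇒disjoint-presets (tV v) (tE e b) other (pOut e′) = ∧-zeroʳ (tgt e′ == v)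
  other-cluster⇒disjoint-presets (tV v) (tE e b) other pO = refl
  other-cluster⇒disjoint-presets (tV v) (tE e b) other (pIn _) = refl
  other-cluster⇒disjoint-presets (tE e b) (tV v) other (pIn e′) = ∧-zeroʳ (e′ == e)
  other-cluster⇒disjoint-presets (tE e b) (tV v) other pI = refl
  other-cluster⇒disjoint-presets (tE e b) (tV v) other pO = refl
  other-cluster⇒disjoint-presets (tE e b) (tV v) other (pOut _) = refl
  other-cluster⇒disjoint-presets (tE e b) (tE e′ b′) other (pIn e″) = ==-∧-== e″ other
  other-cluster⇒disjoint-presets (tE e b) (tE e′ b′) other pI = refl
  other-cluster⇒disjoint-presets (tE e b) (tE e′ b′) other pO = refl
  other-cluster⇒disjoint-presets (tE e b) (tE e′ b′) other (pOut _) = refl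

  restrict : TransW → (TransW → ℚ) → TransW → ℚ
  restrict r F t′ = if sameCluster r t′ then F t′ else 0ℚ

  clusterSum : (TransW → ℚ) → TransW → ℚ
  clusterSum F (tV v) = F (tV v)
  clusterSum F (tE e _) = F (tE e false) + F (tE e true)

  sumℚ-transitions : ∀ F → sumℚ transitionsW F ≡
    sumℚ (allFin m) (λ e → F (tE e false)) + (sumℚ (allFin m) (λ e → F (tE e true)) + sumℚ (allFin n) (λ v → F (tV v)))
  sumℚ-transitions F = trans (sumℚ-++ (map (λ e → tE e false) (allFin m)) _ F)
    (cong₂ _+_ (sumℚ-map _ (allFin m) F)
               (trans (sumℚ-++ (map (λ e → tE e true) (allFin m)) _ F) (cong₂ _+_ (sumℚ-map _ (allFin m) F) (sumℚ-map tV (allFin n) F))))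

  sumℚ-restrict : ∀ r F → sumℚ transitionsW (restrict r F) ≡ clusterSum F r
  sumℚ-restrict (tV v) F = begin
    sumℚ transitionsW (restrict (tV v) F)
      ≡⟨ sumℚ-transitions (restrict (tV v) F) ⟩
    sumℚ (allFin m) (λ _ → 0ℚ) + (sumℚ (allFin m) (λ _ → 0ℚ) + sumℚ (allFin n) (λ v′ → restrict (tV v) F (tV v′)))
      ≡⟨ cong₂ _+_ (sumℚ-zero (allFin m) (λ _ → refl)) (cong₂ _+_ (sumℚ-zero (allFin m) (λ _ → refl))
           (sumℚ-allFin-single n _ v (λ v′ v′≢v → cong (λ b → if b then F (tV v′) else 0ℚ) (≢⇒==-false (v′≢v ∘ sym))))) ⟩
    0ℚ + (0ℚ + restrict (tV v) F (tV v))
      ≡⟨ trans (ℚ.+-identityˡ _) (ℚ.+-identityˡ _) ⟩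
    restrict (tV v) F (tV v)
      ≡⟨ cong (λ b → if b then F (tV v) else 0ℚ) (==-refl v) ⟩
    F (tV v)
      ∎
    where open ≡-Reasoning
  sumℚ-restrict (tE e b) F = begin
    sumℚ transitionsW (restrict (tE e b) F)
      ≡⟨ sumℚ-transitions (restrict (tE e b) F) ⟩
    sumℚ (allFin m) (λ e′ → restrict (tE e b) F (tE e′ false)) + (sumℚ (allFin m) (λ e′ → restrict (tE e b) F (tE e′ true)) + sumℚ (allFin n) (λ _ → 0ℚ))
      ≡⟨ cong₂ _+_ (only-e false) (cong₂ _+_ (only-e true) (sumℚ-zero (allFin n) (λ _ → refl))) ⟩
    restrict (tE e b) F (tE e false) + (restrict (tE e b) F (tE e true) + 0ℚ)
      ≡⟨ cong₂ (λ b₀ b₁ → (if b₀ then F (tE e false) else 0ℚ) + ((if b₁ then F (tE e true) else 0ℚ) + 0ℚ)) (==-refl e) (==-refl e) ⟩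
    F (tE e false) + (F (tE e true) + 0ℚ)
      ≡⟨ cong (F (tE e false) +_) (ℚ.+-identityʳ _) ⟩
    F (tE e false) + F (tE e true)
      ∎
    where
    open ≡-Reasoning
    only-e : ∀ b′ → sumℚ (allFin m) (λ e′ → restrict (tE e b) F (tE e′ b′)) ≡ restrict (tE e b) F (tE e b′)
    only-e b′ = sumℚ-allFin-single m _ e λ e′ e′≢e → cong (λ c → if c then F (tE e′ b′) else 0ℚ) (≢⇒==-false (e′≢e ∘ sym))

  clusterSum-weights : ∀ r → clusterSum wW r ≡ 1ℚ
  clusterSum-weights (tV v) = refl
  clusterSum-weights (tE e b) = solve 1 (λ a → (con 1ℚ :- a) :+ a := con 1ℚ) refl (p e)

  isVertexTransition : TransW → Bool
  isVertexTransition (tV _) = true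
  isVertexTransition (tE _ _) = false

  clusterSum-vertex : ∀ r (F : TransW → ℚ) → isVertexTransition r ≡ true → clusterSum (λ t′ → wW t′ * F t′) r ≡ F r
  clusterSum-vertex (tV v) F _ = ℚ.*-identityˡ (F (tV v))

  clusterSum-edge : ∀ r (F : TransW → ℚ) e → isEdge e r ≡ true →
    clusterSum (λ t′ → wW t′ * F t′) r ≡ p e * F (tE e true) + (1ℚ - p e) * F (tE e false)
  clusterSum-edge (tE e₀ b) F e same with ==⇒≡ {a = e} {e₀} same
  ... | refl = ℚ.+-comm ((1ℚ - p e₀) * F (tE e₀ false)) (p e₀ * F (tE e₀ true))

  module _ {h : List TransW} (I : FiringInvariant h) where

    inConflict≡sameCluster : ∀ r → enabled r (mark h) ≡ true → ∀ t′ → inConflict r (mark h) t′ ≡ sameCluster r t′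
    inConflict≡sameCluster r en t′ with sameCluster r t′ in same
    ... | true = cong₂ _∧_ t′-enabled shares-input
      where
      same-preset : ∀ q → preW q r ≡ preW q t′
      same-preset = same-cluster⇒same-preset r t′ same
      t′-enabled : enabled t′ (mark h) ≡ true
      t′-enabled = marked⇒enabled I t′ λ q pq → enabled⇒marked I r en q (trans (same-preset q) pq)
      shares-input : any (λ q → preW q r ∧ preW q t′) placesW ≡ true
      shares-input with input-place r
      ... | q , pq , _ = any-complete (λ q → preW q r ∧ preW q t′) placesW (places-complete q) (cong₂ _∧_ pq (trans (sym (same-preset q)) pq))
    ... | false = trans (cong (enabled t′ (mark h) ∧_) (any-false (λ q → preW q r ∧ preW q t′) placesW λ q _ → other-cluster⇒disjoint-presets r t′ same q))
                        (∧-zeroʳ _)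

    conflict-weight : ∀ r → enabled r (mark h) ≡ true → sumℚ (conflictSet r (mark h)) wW ≡ 1ℚ
    conflict-weight r en = begin
      sumℚ (boolFilter (inConflict r (mark h)) transitionsW) wW
        ≡⟨ sumℚ-boolFilter transitionsW (inConflict r (mark h)) wW ⟩
      sumℚ transitionsW (λ t′ → if inConflict r (mark h) t′ then wW t′ else 0ℚ)
        ≡⟨ sumℚ-cong transitionsW (λ t′ → cong (λ b → if b then wW t′ else 0ℚ) (inConflict≡sameCluster r en t′)) ⟩
      sumℚ transitionsW (restrict r wW)
        ≡⟨ sumℚ-restrict r wW ⟩
      clusterSum wW r
        ≡⟨ clusterSum-weights r ⟩
      1ℚ
        ∎
      where open ≡-Reasoning

module Scheduled (𝒫 : PERT) (isP : PERTDefs.IsPERT 𝒫) (Sch : Semantics.Scheduler (PERTDefs.W𝒫 𝒫)) where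
  open PERT 𝒫
  open PERTDefs 𝒫
  open Semantics W𝒫
  open Net 𝒫 isP
  open Firing W𝒫
  open Complete places-complete transitions-complete
  open Clusters 𝒫 isP

  chosen-enabled : ∀ h → someEnabled (mark h) ≡ true → enabled (S Sch h) (mark h) ≡ true
  chosen-enabled = proj₂ Sch

  module _ {h : List TransW} (I : FiringInvariant h) (live : someEnabled (mark h) ≡ true) where

    stepProb≡restrict : ∀ t′ → stepProb Sch h t′ ≡ restrict (S Sch h) wW t′
    stepProb≡restrict t′
      rewrite conflict-weight I (S Sch h) (chosen-enabled h live)
            | inConflict≡sameCluster I (S Sch h) (chosen-enabled h live) t′
      with sameCluster (S Sch h) t′
    ... | true = ℚ.*-identityʳ (wW t′)
    ... | false = refl

    expectStep-live : ∀ g → expectStep Sch h g ≡ clusterSum (λ t′ → wW t′ * g (h ∷ʳ t′)) (S Sch h)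
    expectStep-live g = trans (sumℚ-cong transitionsW λ t′ → trans (cong (_* g (h ∷ʳ t′)) (stepProb≡restrict t′)) (restrict-* t′))
                        (sumℚ-restrict (S Sch h) _)
      where
      restrict-* : ∀ t′ → restrict (S Sch h) wW t′ * g (h ∷ʳ t′) ≡ restrict (S Sch h) (λ t′ → wW t′ * g (h ∷ʳ t′)) t′
      restrict-* t′ with sameCluster (S Sch h) t′
      ... | true = refl
      ... | false = ℚ.*-zeroˡ (g (h ∷ʳ t′))

  expectStep-dead : ∀ {h} → someEnabled (mark h) ≡ false → ∀ g → expectStep Sch h g ≡ 0ℚ
  expectStep-dead {h} dead g = sumℚ-zero transitionsW λ t′ → trans (cong (_* g (h ∷ʳ t′)) (step≡0 t′)) (ℚ.*-zeroˡ (g (h ∷ʳ t′)))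
    where
    step≡0 : ∀ t′ → stepProb Sch h t′ ≡ 0ℚ
    step≡0 t′ rewrite noneEnabled-sound dead t′ = refl

module Runs (𝒫 : PERT) (isP : PERTDefs.IsPERT 𝒫) (Sch : Semantics.Scheduler (PERTDefs.W𝒫 𝒫)) where
  open PERT 𝒫
  open PERTDefs 𝒫
  open Semantics W𝒫
  open Paths 𝒫
  open Net 𝒫 isP
  open Timing 𝒫 isP
  open Clusters 𝒫 isP
  open Scheduled 𝒫 isP Sch
  open Expectation 𝒫

  -- The scheduler only selects a cluster; within an edge cluster the outcome decides.
  choose : TransW → Outcome → TransW
  choose (tE e _) x = tE e (x e)
  choose (tV v) x = tV v

  run : ℕ → Outcome → List TransW
  run ℕ.zero x = []
  run (ℕ.suc j) x = run j x ∷ʳ choose (S Sch (run j x)) x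

  alive : ℕ → Outcome → Bool
  alive ℕ.zero x = true
  alive (ℕ.suc j) x = alive j x ∧ someEnabled (mark (run j x))

  choose-follows : ∀ r x → FollowsOutcome x (choose r x)
  choose-follows (tE e b) x = refl
  choose-follows (tV v) x = _

  choose-enabled : ∀ {h} → FiringInvariant h → ∀ r x → enabled r (mark h) ≡ true → enabled (choose r x) (mark h) ≡ true
  choose-enabled I (tV v) x en = en
  choose-enabled I (tE e b) x en = marked⇒enabled I (tE e (x e)) λ q pq →
    enabled⇒marked I (tE e b) en q (trans (same-cluster⇒same-preset (tE e b) (tE e (x e)) (==-refl e) q) pq)

  chosen : ℕ → Outcome → TransW
  chosen j x = S Sch (run j x)

  step-enabled : ∀ j x → FiringInvariant (run j x) → someEnabled (mark (run j x)) ≡ true →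
    enabled (choose (chosen j x) x) (mark (run j x)) ≡ true
  step-enabled j x I live = choose-enabled I (chosen j x) x (chosen-enabled (run j x) live)

  run-invariants : ∀ j x → alive j x ≡ true → FiringInvariant (run j x) × TimingInvariant x (run j x)
  run-invariants ℕ.zero x _ = firing-[] , timing-[] x
  run-invariants (ℕ.suc j) x a with ∧-true {alive j x} a
  ... | a′ , live with run-invariants j x a′
  ...   | I , J = firing-∷ʳ I _ (step-enabled j x I live) , timing-∷ʳ I J _ (step-enabled j x I live) (choose-follows (chosen j x) x)

  alive-bound : ∀ j x → alive j x ≡ true → unfired (run j x) ℕ.+ j ℕ.≤ n ℕ.+ m
  alive-bound ℕ.zero x _ = ℕ.≤-trans (ℕ.≤-reflexive (ℕ.+-identityʳ _)) (unfired≤ [])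
  alive-bound (ℕ.suc j) x a with ∧-true {alive j x} a
  ... | a′ , live = begin
    unfired (run (ℕ.suc j) x) ℕ.+ ℕ.suc j   ≡⟨ ℕ.+-suc _ j ⟩
    ℕ.suc (unfired (run (ℕ.suc j) x)) ℕ.+ j ≤⟨ ℕ.+-monoˡ-≤ j (unfired-∷ʳ I _ (step-enabled j x I live)) ⟩
    unfired (run j x) ℕ.+ j                 ≤⟨ alive-bound j x a′ ⟩
    n ℕ.+ m                                 ∎
    where
    open ℕ.≤-Reasoning
    I : FiringInvariant (run j x)
    I = proj₁ (run-invariants j x a′)

  alive-end : ∀ x → alive (ℕ.suc (n ℕ.+ m)) x ≡ false
  alive-end x with alive (ℕ.suc (n ℕ.+ m)) x in a
  ... | false = refl
  ... | true = ⊥-elim (ℕ.1+n≰n (ℕ.m+n≤o⇒n≤o _ (alive-bound (ℕ.suc (n ℕ.+ m)) x a)))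

  choose-cong : ∀ r {x y : Outcome} → x ≗ y → choose r x ≡ choose r y
  choose-cong (tE e b) x≗y = cong (tE e) (x≗y e)
  choose-cong (tV v) x≗y = refl

  run-cong : ∀ j {x y : Outcome} → x ≗ y → run j x ≡ run j y
  run-cong ℕ.zero x≗y = refl
  run-cong (ℕ.suc j) {x} {y} x≗y rewrite run-cong j x≗y = cong (run j y ∷ʳ_) (choose-cong (S Sch (run j y)) x≗y)

  alive-cong : ∀ j {x y : Outcome} → x ≗ y → alive j x ≡ alive j y
  alive-cong ℕ.zero x≗y = refl
  alive-cong (ℕ.suc j) x≗y rewrite alive-cong j x≗y | run-cong j x≗y = refl

  edge-unfired-∷ʳ : ∀ j x e → edgeFired (run (ℕ.suc j) x) e ≡ false →
    edgeFired (run j x) e ≡ false × isEdge e (choose (S Sch (run j x)) x) ≡ false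
  edge-unfired-∷ʳ j x e unfired = ∨-false (trans (sym (edgeFired-∷ʳ (run j x) _ e)) unfired)

  choose-[]≔ : ∀ r x e b → isEdge e (choose r x) ≡ false → choose r (x [ e ]≔ b) ≡ choose r x
  choose-[]≔ (tE e′ b′) x e b other = cong (tE e′) (updateAt-minimal e′ e x (==-false⇒≢ other ∘ sym))
  choose-[]≔ (tV v) x e b _ = refl

  run-[]≔ : ∀ j x e b → edgeFired (run j x) e ≡ false → run j (x [ e ]≔ b) ≡ run j x
  run-[]≔ ℕ.zero x e b _ = refl
  run-[]≔ (ℕ.suc j) x e b unfired with edge-unfired-∷ʳ j x e unfired
  ... | unfired′ , not-chosen rewrite run-[]≔ j x e b unfired′ = cong (run j x ∷ʳ_) (choose-[]≔ (S Sch (run j x)) x e b not-chosen)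

  alive-[]≔ : ∀ j x e b → edgeFired (run j x) e ≡ false → alive j (x [ e ]≔ b) ≡ alive j x
  alive-[]≔ ℕ.zero x e b _ = refl
  alive-[]≔ (ℕ.suc j) x e b unfired with edge-unfired-∷ʳ j x e unfired
  ... | unfired′ , _ rewrite alive-[]≔ j x e b unfired′ | run-[]≔ j x e b unfired′ = refl

  choose-vertex : ∀ r x → isVertexTransition r ≡ true → choose r x ≡ r
  choose-vertex (tV v) x _ = refl

  choose-edge-[]≔ : ∀ r x e b → isEdge e r ≡ true → choose r (x [ e ]≔ b) ≡ tE e b
  choose-edge-[]≔ (tE e₀ b₀) x e b same with ==⇒≡ {a = e} {e₀} same
  ... | refl = cong (tE e) (updateAt-updates e x)

module Coupling (𝒫 : PERT) (isP : PERTDefs.IsPERT 𝒫) (Sch : Semantics.Scheduler (PERTDefs.W𝒫 𝒫)) where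
  open PERT 𝒫
  open PERTDefs 𝒫
  open Semantics W𝒫
  open Firing W𝒫
  open Paths 𝒫
  open Net 𝒫 isP
  open Clusters 𝒫 isP
  open Scheduled 𝒫 isP Sch
  open Runs 𝒫 isP Sch
  open Expectation 𝒫

  byChoice : Bool → TransW → ℚ → (Fin m → ℚ) → ℚ
  byChoice a r c₀ c = (if a ∧ isVertexTransition r then c₀ else 0ℚ) + sumℚ (allFin m) (λ e → if a ∧ isEdge e r then c e else 0ℚ)

  byChoice-false : ∀ r c₀ c → byChoice false r c₀ c ≡ 0ℚ
  byChoice-false r c₀ c = trans (ℚ.+-identityˡ _) (sumℚ-zero (allFin m) (λ _ → refl))

  byChoice-true : ∀ r c₀ c d → (isVertexTransition r ≡ true → c₀ ≡ d) → (∀ e → isEdge e r ≡ true → c e ≡ d) →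
    byChoice true r c₀ c ≡ d
  byChoice-true (tV v) c₀ c d vertex _ =
    trans (cong₂ _+_ (vertex refl) (sumℚ-zero (allFin m) (λ _ → refl))) (ℚ.+-identityʳ d)
  byChoice-true (tE e₀ b) c₀ c d _ edge =
    trans (ℚ.+-identityˡ _) (trans (sumℚ-allFin-single m _ e₀ λ e e≢e₀ → cong (λ b → if b then c e else 0ℚ) (≢⇒==-false e≢e₀)) pick)
    where
    pick : (if e₀ == e₀ then c e₀ else 0ℚ) ≡ d
    pick rewrite ==-refl e₀ = edge e₀ (==-refl e₀)

  if-byChoice : ∀ a r d → (if a then d else 0ℚ) ≡ byChoice a r d (λ _ → d)
  if-byChoice false r d = sym (byChoice-false r d (λ _ → d))
  if-byChoice true r d = sym (byChoice-true r d (λ _ → d) d (λ _ → refl) (λ _ _ → refl))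

  𝔼-byChoice : ∀ (a : Outcome → Bool) (r : Outcome → TransW) (c₀ : Outcome → ℚ) (c : Outcome → Fin m → ℚ) → 𝔼 p (λ x → byChoice (a x) (r x) (c₀ x) (c x)) ≡
    𝔼 p (λ x → if a x ∧ isVertexTransition (r x) then c₀ x else 0ℚ) + sumℚ (allFin m) (λ e → 𝔼 p (λ x → if a x ∧ isEdge e (r x) then c x e else 0ℚ))
  𝔼-byChoice a r c₀ c = trans (𝔼-+ p (λ x → if a x ∧ isVertexTransition (r x) then c₀ x else 0ℚ) _)
    (cong (𝔼 p (λ x → if a x ∧ isVertexTransition (r x) then c₀ x else 0ℚ) +_) (𝔼-sumℚ p (allFin m) (λ e x → if a x ∧ isEdge e (r x) then c x e else 0ℚ)))

  edgeChosen : ℕ → Fin m → Outcome → Bool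
  edgeChosen j e x = alive (ℕ.suc j) x ∧ isEdge e (chosen j x)

  average : ℕ → (List TransW → ℚ) → Fin m → Outcome → ℚ
  average j g e x = p e * g (run j x ∷ʳ tE e true) + (1ℚ - p e) * g (run j x ∷ʳ tE e false)

  expectStep-byChoice : ∀ j g x → (if alive j x then expectStep Sch (run j x) g else 0ℚ) ≡
    byChoice (alive (ℕ.suc j) x) (chosen j x) (g (run (ℕ.suc j) x)) (λ e → average j g e x)
  expectStep-byChoice j g x with alive j x in a
  ... | false = sym (byChoice-false (chosen j x) (g (run (ℕ.suc j) x)) (λ e → average j g e x))
  ... | true with someEnabled (mark (run j x)) in live
  ...   | false = trans (expectStep-dead live g) (sym (byChoice-false (chosen j x) (g (run (ℕ.suc j) x)) (λ e → average j g e x)))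
  ...   | true = sym (byChoice-true (chosen j x) _ _ _ vertex edge)
    where
    I : FiringInvariant (run j x)
    I = proj₁ (run-invariants j x a)
    vertex : isVertexTransition (chosen j x) ≡ true → g (run (ℕ.suc j) x) ≡ expectStep Sch (run j x) g
    vertex isV = trans (cong (λ t′ → g (run j x ∷ʳ t′)) (choose-vertex (chosen j x) x isV))
                       (sym (trans (expectStep-live I live g) (clusterSum-vertex (chosen j x) _ isV)))
    edge : ∀ e → isEdge e (chosen j x) ≡ true → average j g e x ≡ expectStep Sch (run j x) g
    edge e isE = sym (trans (expectStep-live I live g) (clusterSum-edge (chosen j x) _ e isE))

  edgeChosen⇒unfired : ∀ j e x → edgeChosen j e x ≡ true → edgeFired (run j x) e ≡ false
  edgeChosen⇒unfired j e x c with ∧-true {alive (ℕ.suc j) x} c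
  ... | a′ , isE with ∧-true {alive j x} a′
  ...   | a , live = chosen-unfired (chosen j x) (chosen-enabled (run j x) live) isE
    where
    chosen-unfired : ∀ r → enabled r (mark (run j x)) ≡ true → isEdge e r ≡ true → edgeFired (run j x) e ≡ false
    chosen-unfired (tE e₀ b) en isE′ with ==⇒≡ {a = e} {e₀} isE′
    ... | refl = proj₂ (edge-enabled (proj₁ (run-invariants j x a)) en)

  fired⇒¬edgeChosen : ∀ j e x b → edgeFired (run j x) e ≡ true → edgeChosen j e (x [ e ]≔ b) ≡ false
  fired⇒¬edgeChosen j e x b fired = contraposeᵇ (λ c → cong not (unfired-in-x c)) (cong not fired)
    where
    y : Outcome
    y = x [ e ]≔ b
    unfired-in-x : edgeChosen j e y ≡ true → edgeFired (run j x) e ≡ false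
    unfired-in-x c = begin
      edgeFired (run j x) e               ≡⟨ cong (λ h → edgeFired h e) (run-cong j (sym ∘ []≔-restore x e b)) ⟩
      edgeFired (run j (y [ e ]≔ x e)) e  ≡⟨ cong (λ h → edgeFired h e) (run-[]≔ j y e (x e) (edgeChosen⇒unfired j e y c)) ⟩
      edgeFired (run j y) e               ≡⟨ edgeChosen⇒unfired j e y c ⟩
      false                               ∎
      where open ≡-Reasoning

  edgeChosen-[]≔ : ∀ j e x b → edgeFired (run j x) e ≡ false → edgeChosen j e (x [ e ]≔ b) ≡ edgeChosen j e x
  edgeChosen-[]≔ j e x b unfired rewrite alive-[]≔ j x e b unfired | run-[]≔ j x e b unfired = refl

  sampled : ℕ → (List TransW → ℚ) → Fin m → Outcome → ℚ
  sampled j g e x = if edgeChosen j e x then g (run (ℕ.suc j) x) else 0ℚ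

  averaged : ℕ → (List TransW → ℚ) → Fin m → Outcome → ℚ
  averaged j g e x = if edgeChosen j e x then average j g e x else 0ℚ

  sampled-ext : ∀ j g e → Extensional (sampled j g e)
  sampled-ext j g e x≗y = cong₂ (λ c h → if c then g h else 0ℚ)
    (cong₂ _∧_ (alive-cong (ℕ.suc j) x≗y) (cong (λ h → isEdge e (S Sch h)) (run-cong j x≗y)))
    (run-cong (ℕ.suc j) x≗y)

  sampled-[]≔ : ∀ j g e x b → edgeFired (run j x) e ≡ false →
    sampled j g e (x [ e ]≔ b) ≡ (if edgeChosen j e x then g (run j x ∷ʳ tE e b) else 0ℚ)
  sampled-[]≔ j g e x b unfired rewrite edgeChosen-[]≔ j e x b unfired with edgeChosen j e x in c
  ... | false = refl
  ... | true = cong g (begin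
    run j (x [ e ]≔ b) ∷ʳ choose (chosen j (x [ e ]≔ b)) (x [ e ]≔ b)
      ≡⟨ cong (λ h → h ∷ʳ choose (S Sch h) (x [ e ]≔ b)) (run-[]≔ j x e b unfired) ⟩
    run j x ∷ʳ choose (chosen j x) (x [ e ]≔ b)
      ≡⟨ cong (run j x ∷ʳ_) (choose-edge-[]≔ (chosen j x) x e b (proj₂ (∧-true {alive (ℕ.suc j) x} c))) ⟩
    run j x ∷ʳ tE e b
      ∎)
    where open ≡-Reasoning

  -- Before e fires, the run does not depend on x e; after it fired, e is never chosen again.
  resampled-sampled : ∀ j g e x → resampled p e (sampled j g e) x ≡ averaged j g e x
  resampled-sampled j g e x with edgeFired (run j x) e in fired
  ... | false = trans (cong₂ (λ u v → p e * u + (1ℚ - p e) * v) (sampled-[]≔ j g e x true fired) (sampled-[]≔ j g e x false fired))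
                      (if-linear (edgeChosen j e x) (p e) (1ℚ - p e) _ _)
  ... | true rewrite fired⇒¬edgeChosen j e x true fired | fired⇒¬edgeChosen j e x false fired
                   | contraposeᵇ (cong not ∘ edgeChosen⇒unfired j e x) (cong not fired) = if-linear false (p e) (1ℚ - p e) 0ℚ 0ℚ

  𝔼-sampled : ∀ j g e → 𝔼 p (sampled j g e) ≡ 𝔼 p (averaged j g e)
  𝔼-sampled j g e = trans (𝔼-resampled p e (sampled j g e) (sampled-ext j g e)) (𝔼-cong p (resampled-sampled j g e))

  coupling-step : ∀ j g → 𝔼 p (λ x → if alive j x then expectStep Sch (run j x) g else 0ℚ) ≡ 𝔼 p (λ x → if alive (ℕ.suc j) x then g (run (ℕ.suc j) x) else 0ℚ)
  coupling-step j g = begin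
    𝔼 p (λ x → if alive j x then expectStep Sch (run j x) g else 0ℚ)
      ≡⟨ 𝔼-cong p (expectStep-byChoice j g) ⟩
    𝔼 p (λ x → byChoice (alive (ℕ.suc j) x) (chosen j x) (advance x) (λ e → average j g e x))
      ≡⟨ 𝔼-byChoice (alive (ℕ.suc j)) (chosen j) advance (λ x e → average j g e x) ⟩
    𝔼 p vertexPart + sumℚ (allFin m) (λ e → 𝔼 p (averaged j g e))
      ≡⟨ cong (𝔼 p vertexPart +_) (sumℚ-cong (allFin m) λ e → sym (𝔼-sampled j g e)) ⟩
    𝔼 p vertexPart + sumℚ (allFin m) (λ e → 𝔼 p (sampled j g e))
      ≡⟨ sym (𝔼-byChoice (alive (ℕ.suc j)) (chosen j) advance (λ x _ → advance x)) ⟩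
    𝔼 p (λ x → byChoice (alive (ℕ.suc j) x) (chosen j x) (advance x) (λ _ → advance x))
      ≡⟨ 𝔼-cong p (λ x → sym (if-byChoice (alive (ℕ.suc j) x) (chosen j x) (advance x))) ⟩
    𝔼 p (λ x → if alive (ℕ.suc j) x then advance x else 0ℚ)
      ∎
    where
    open ≡-Reasoning
    advance : Outcome → ℚ
    advance x = g (run (ℕ.suc j) x)
    vertexPart : Outcome → ℚ
    vertexPart x = if alive (ℕ.suc j) x ∧ isVertexTransition (chosen j x) then advance x else 0ℚ

  coupling : ∀ j g → sumℚ (seqs Sch j) (λ σ → prob Sch σ * g σ) ≡ 𝔼 p (λ x → if alive j x then g (run j x) else 0ℚ)
  coupling ℕ.zero g = trans (ℚ.+-identityʳ _) (trans (ℚ.*-identityˡ (g [])) (sym (𝔼-const m p (g []))))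
  coupling (ℕ.suc j) g = begin
    sumℚ (seqs Sch (ℕ.suc j)) (λ σ → prob Sch σ * g σ)                 ≡⟨ seqs-step Sch j g ⟩
    sumℚ (seqs Sch j) (λ σ → prob Sch σ * expectStep Sch σ g)          ≡⟨ coupling j (λ h → expectStep Sch h g) ⟩
    𝔼 p (λ x → if alive j x then expectStep Sch (run j x) g else 0ℚ)   ≡⟨ coupling-step j g ⟩
    𝔼 p (λ x → if alive (ℕ.suc j) x then g (run (ℕ.suc j) x) else 0ℚ) ∎
    where open ≡-Reasoning

module Reaching (𝒫 : PERT) (isP : PERTDefs.IsPERT 𝒫) (Sch : Semantics.Scheduler (PERTDefs.W𝒫 𝒫)) where
  open PERT 𝒫
  open PERTDefs 𝒫
  open Semantics W𝒫
  open Net 𝒫 isP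
  open Runs 𝒫 isP Sch
  open Coupling 𝒫 isP Sch
  open Expectation 𝒫

  prefixes-not-𝐨 : ∀ j x → alive (ℕ.suc j) x ≡ true → any (isO Sch) (inits (run j x)) ≡ false
  prefixes-not-𝐨 ℕ.zero x a = trans (∨-identityʳ _) (live⇒¬𝐨 [] (proj₂ (∧-true {true} a)))
  prefixes-not-𝐨 (ℕ.suc j) x a with ∧-true {alive (ℕ.suc j) x} a
  ... | a′ , live = begin
    any (isO Sch) (inits (run (ℕ.suc j) x))
      ≡⟨ cong (any (isO Sch)) (inits-∷ʳ (run j x) _) ⟩
    any (isO Sch) (inits (run j x) ∷ʳ run (ℕ.suc j) x)
      ≡⟨ any-∷ʳ (isO Sch) (inits (run j x)) (run (ℕ.suc j) x) ⟩
    any (isO Sch) (inits (run j x)) ∨ isO Sch (run (ℕ.suc j) x)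
      ≡⟨ cong₂ _∨_ (prefixes-not-𝐨 j x a′) (live⇒¬𝐨 (run (ℕ.suc j) x) live) ⟩
    false
      ∎
    where open ≡-Reasoning

  firstReach-run : ∀ j x → alive j x ≡ true → firstReach Sch (run j x) ≡ isO Sch (run j x)
  firstReach-run ℕ.zero x _ = ∧-identityʳ _
  firstReach-run (ℕ.suc j) x a
    rewrite take-length-inits-∷ʳ (run j x) (choose (chosen j x) x) | prefixes-not-𝐨 j x a = ∧-identityʳ _

  module _ (f : List TransW → ℚ) (V : Outcome → ℚ)
           (f-final : ∀ j x → alive j x ≡ true → someEnabled (mark (run j x)) ≡ false → f (run j x) ≡ V x) where

    first-reach-at : ∀ j x → (if alive j x then (if firstReach Sch (run j x) then f (run j x) else 0ℚ) else 0ℚ)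
      ≡ ([ alive j x ]ℚ - [ alive j x ∧ someEnabled (mark (run j x)) ]ℚ) * V x
    first-reach-at j x with alive j x in a
    ... | false = sym (ℚ.*-zeroˡ (V x))
    ... | true rewrite firstReach-run j x a with someEnabled (mark (run j x)) in live
    ...   | true rewrite live⇒¬𝐨 (run j x) live = sym (ℚ.*-zeroˡ (V x))
    ...   | false rewrite dead⇒𝐨 (proj₁ (run-invariants j x a)) live = trans (f-final j x a live) (sym (ℚ.*-identityˡ (V x)))

    sumℚ-reachedWithin : ∀ k → sumℚ (reachedWithin Sch k) (λ σ → prob Sch σ * f σ) ≡ 𝔼 p (λ x → V x * (1ℚ - [ alive (ℕ.suc k) x ]ℚ))
    sumℚ-reachedWithin k = begin
      sumℚ (reachedWithin Sch k) (λ σ → prob Sch σ * f σ)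
        ≡⟨ sumℚ-concatMap (λ j → boolFilter (firstReach Sch) (seqs Sch j)) (upTo (ℕ.suc k)) (λ σ → prob Sch σ * f σ) ⟩
      sumℚ (upTo (ℕ.suc k)) (λ j → sumℚ (boolFilter (firstReach Sch) (seqs Sch j)) (λ σ → prob Sch σ * f σ))
        ≡⟨ sumℚ-cong (upTo (ℕ.suc k)) (λ j → trans (sumℚ-boolFilter (seqs Sch j) (firstReach Sch) (λ σ → prob Sch σ * f σ))
                                                    (sumℚ-cong (seqs Sch j) λ σ → if-*ˡ (firstReach Sch σ) (prob Sch σ) (f σ))) ⟩
      sumℚ (upTo (ℕ.suc k)) (λ j → sumℚ (seqs Sch j) (λ σ → prob Sch σ * (if firstReach Sch σ then f σ else 0ℚ)))
        ≡⟨ sumℚ-cong (upTo (ℕ.suc k)) (λ j → trans (coupling j (λ σ → if firstReach Sch σ then f σ else 0ℚ)) (𝔼-cong p (first-reach-at j))) ⟩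
      sumℚ (upTo (ℕ.suc k)) (λ j → 𝔼 p (λ x → ([ alive j x ]ℚ - [ alive (ℕ.suc j) x ]ℚ) * V x))
        ≡⟨ sym (𝔼-sumℚ p (upTo (ℕ.suc k)) (λ j x → ([ alive j x ]ℚ - [ alive (ℕ.suc j) x ]ℚ) * V x)) ⟩
      𝔼 p (λ x → sumℚ (upTo (ℕ.suc k)) (λ j → ([ alive j x ]ℚ - [ alive (ℕ.suc j) x ]ℚ) * V x))
        ≡⟨ 𝔼-cong p telescope ⟩
      𝔼 p (λ x → V x * (1ℚ - [ alive (ℕ.suc k) x ]ℚ))
        ∎
      where
      open ≡-Reasoning
      if-*ˡ : ∀ c a b → (if c then a * b else 0ℚ) ≡ a * (if c then b else 0ℚ)
      if-*ˡ true a b = refl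
      if-*ˡ false a b = sym (ℚ.*-zeroʳ a)
      telescope : ∀ x → sumℚ (upTo (ℕ.suc k)) (λ j → ([ alive j x ]ℚ - [ alive (ℕ.suc j) x ]ℚ) * V x) ≡ V x * (1ℚ - [ alive (ℕ.suc k) x ]ℚ)
      telescope x = begin
        sumℚ (upTo (ℕ.suc k)) (λ j → ([ alive j x ]ℚ - [ alive (ℕ.suc j) x ]ℚ) * V x)
          ≡⟨ sumℚ-cong (upTo (ℕ.suc k)) (λ j → ℚ.*-comm ([ alive j x ]ℚ - [ alive (ℕ.suc j) x ]ℚ) (V x)) ⟩
        sumℚ (upTo (ℕ.suc k)) (λ j → V x * ([ alive j x ]ℚ - [ alive (ℕ.suc j) x ]ℚ))
          ≡⟨ sumℚ-*ˡ (upTo (ℕ.suc k)) (V x) (λ j → [ alive j x ]ℚ - [ alive (ℕ.suc j) x ]ℚ) ⟩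
        V x * sumℚ (upTo (ℕ.suc k)) (λ j → [ alive j x ]ℚ - [ alive (ℕ.suc j) x ]ℚ)
          ≡⟨ cong (V x *_) (sumℚ-upTo-telescope (ℕ.suc k) (λ j → [ alive j x ]ℚ)) ⟩
        V x * (1ℚ - [ alive (ℕ.suc k) x ]ℚ)
          ∎

module Truncations (𝒫 : PERT) (isP : PERTDefs.IsPERT 𝒫) (Sch : Semantics.Scheduler (PERTDefs.W𝒫 𝒫)) where
  open PERT 𝒫
  open PERTDefs 𝒫
  open IsPERT isP
  open Semantics W𝒫
  open Paths 𝒫
  open Timing 𝒫 isP
  open Runs 𝒫 isP Sch
  open Reaching 𝒫 isP Sch
  open Expectation 𝒫

  Preach≡ : ∀ k → Preach Sch k ≡ 𝔼 p (λ x → 1ℚ * (1ℚ - [ alive (ℕ.suc k) x ]ℚ))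
  Preach≡ k = trans (sumℚ-cong (reachedWithin Sch k) (λ σ → sym (ℚ.*-identityʳ (prob Sch σ))))
                    (sumℚ-reachedWithin (λ _ → 1ℚ) (λ _ → 1ℚ) (λ _ _ _ _ → refl) k)

  Etrunc≡ : ∀ PD → (∀ x → IsPD x (PD x)) → ∀ k → Etrunc Sch k ≡ 𝔼 p (λ x → ℕ→ℚ (PD x) * (1ℚ - [ alive (ℕ.suc k) x ]ℚ))
  Etrunc≡ PD PD-correct = sumℚ-reachedWithin timeℚ (ℕ→ℚ ∘ PD) time-final
    where
    time-final : ∀ j x → alive j x ≡ true → someEnabled (mark (run j x)) ≡ false → timeℚ (run j x) ≡ ℕ→ℚ (PD x)
    time-final j x a dead with run-invariants j x a
    ... | I , J with dead⇒time I J dead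
    ...   | D , time≡ , lp rewrite time≡ = cong ℕ→ℚ (longestPath-unique lp (PD-correct x))

  at-horizon : ∀ W → 𝔼 p (λ x → W x * (1ℚ - [ alive (ℕ.suc (n ℕ.+ m)) x ]ℚ)) ≡ 𝔼 p W
  at-horizon W = 𝔼-cong p λ x → trans (cong (λ b → W x * (1ℚ - [ b ]ℚ)) (alive-end x)) (ℚ.*-identityʳ (W x))

  truncated≤ : ∀ (W : Outcome → ℚ) → (∀ x → 0ℚ ≤ W x) → ∀ k → 𝔼 p (λ x → W x * (1ℚ - [ alive (ℕ.suc k) x ]ℚ)) ≤ 𝔼 p W
  truncated≤ W 0≤W k = 𝔼-mono p p-lower p-upper λ x → factor≤ x (alive (ℕ.suc k) x)
    where
    factor≤ : ∀ x b → W x * (1ℚ - [ b ]ℚ) ≤ W x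
    factor≤ x false = ℚ.≤-reflexive (ℚ.*-identityʳ (W x))
    factor≤ x true = subst (_≤ W x) (sym (ℚ.*-zeroʳ (W x))) (0≤W x)

lemma3 : (𝒫 : PERT) → PERTDefs.IsPERT 𝒫 → (PD : PERTDefs.Outcome 𝒫 → ℕ) → (∀ x → PERTDefs.IsPD 𝒫 x (PD x)) → (Sch : Semantics.Scheduler (PERTDefs.W𝒫 𝒫)) → Semantics.ETIs (PERTDefs.W𝒫 𝒫) Sch (PERTDefs.expectedPD 𝒫 PD)
lemma3 𝒫 isP PD PD-correct Sch = bounded , approached , reached
  where
  open PERT 𝒫
  open PERTDefs 𝒫
  open Semantics W𝒫
  open Expectation 𝒫
  open Truncations 𝒫 isP Sch

  bounded : ∀ k → Etrunc Sch k ≤ expectedPD PD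
  bounded k = subst (_≤ expectedPD PD) (sym (Etrunc≡ PD PD-correct k)) (truncated≤ (ℕ→ℚ ∘ PD) (ℕ→ℚ-nonneg ∘ PD) k)

  approached : ∀ ε → 0ℚ < ε → ∃[ k ] (expectedPD PD - ε < Etrunc Sch k)
  approached ε 0<ε = n ℕ.+ m , subst (expectedPD PD - ε <_) (sym (trans (Etrunc≡ PD PD-correct (n ℕ.+ m)) (at-horizon (ℕ→ℚ ∘ PD))))
                                      (p-q<p (expectedPD PD) ε 0<ε)

  reached : ∀ ε → 0ℚ < ε → ∃[ k ] (1ℚ - ε < Preach Sch k)
  reached ε 0<ε = n ℕ.+ m , subst (1ℚ - ε <_) (sym (trans (Preach≡ (n ℕ.+ m)) (trans (at-horizon (λ _ → 1ℚ)) (𝔼-const m p 1ℚ))))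
                                 (p-q<p 1ℚ ε 0<ε)
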